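{- For every integer $l\ge1$ and every $n\in\{0,\dots,l\}$, \[ \#Y_{l,n}=\frac{1}{l}\sum_{m\mid l}\varphi\Bigl(\frac{l}{m}\Bigr)\bigl(2^m-L_m^n\bigr), \] where the sum is over positive divisors $m$ of $l$ and $\varphi$ is Euler's totient function.
   Context: For $l\ge1$, $X_l=\{y,z\}^l$ is the set of $l$-tuples of two symbols $y,z$, with $\mathbb{Z}/l\mathbb{Z}$ acting by cyclic shifts $j(u_1,\dots,u_l)=(u_{j+1},\dots,u_{j+l})$ (indices modulo $l$). For $n\in\{0,\dots,l\}$, $X_{l,n}\subset X_l$ is the set of tuples containing at least $n$ consecutive $z$'s when read cyclically; it is invariant under the action, and $Y_{l,n}=X_{l,n}/(\mathbb{Z}/l\mathbb{Z})$ is its set of orbits. For $n\ge1$, the $n$-step Lucas sequence is $L_m^n=2^m-1$ for $m=1,\dots,n$ and $L_m^n=L_{m-1}^n+\cdots+L_{m-n}^n$ for $m\ge n+1$; $L_m^0=0$ for all $m\ge1$. -}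

module Defs where

open import Data.Bool using (Bool; true; false)
open import Data.Nat using (ℕ; zero; suc; _+_; _*_; _∸_; _^_; _<_; _≤?_; _/_; NonZero)
open import Data.Nat.GCD using (gcd)
open import Data.Nat.Divisibility using (_∣?_)
open import Data.Nat.Properties using (_≟_)
open import Data.Fin using (Fin; toℕ)
open import Data.Vec using (Vec; []; _∷_; _∷ʳ_; lookup)
open import Data.Nat.ListAction using (sum)
open import Data.List using (List; []; _∷_; take; map; filter; upTo; length)
open import Data.List.Membership.Propositional using (_∈_)
open import Data.List.Relation.Unary.All using (All)
open import Data.List.Relation.Unary.AllPairs using (AllPairs)
open import Data.Product using (Σ; _×_; ∃; ∃-syntax)
open import Data.Integer as ℤ using (ℤ; +_)
open import Relation.Binary.PropositionalEquality using (_≡_)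
open import Relation.Nullary using (¬_)
open import Relation.Nullary.Decidable using (does)

-- X_l : l-tuples over {y,z}; we encode  z = true, y = false.
Word : ℕ → Set
Word l = Vec Bool l

rot : ∀ {l} → Word l → Word l
rot []       = []
rot (x ∷ xs) = xs ∷ʳ x

-- action of j ∈ ℤ/lℤ (represented by j ∈ {0,…,l-1}):
-- j(u₁,…,u_l) = (u_{j+1},…,u_{j+l}), i.e. rot iterated j times
shift : ∀ {l} → ℕ → Word l → Word l
shift zero    u = u
shift (suc j) u = rot (shift j u)

-- u ∈ X_{l,n}: u contains at least n consecutive z's read cyclically,
-- i.e. for some start j the entries u_{j+1},…,u_{j+n} (indices mod l) are all z.
HasRun : ∀ {l} → ℕ → Word l → Set
HasRun {l} n u = ∃[ j ] (j < l × (∀ (k : Fin l) → toℕ k < n → lookup (shift j u) k ≡ true))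

SameOrbit : ∀ {l} → Word l → Word l → Set
SameOrbit {l} u v = ∃[ j ] (j < l × shift j u ≡ v)

-- R is a complete system of representatives of the orbits Y_{l,n} = X_{l,n}/(ℤ/lℤ):
-- all elements lie in X_{l,n}, every element of X_{l,n} is in the orbit of some
-- element of R, and distinct entries of R lie in distinct orbits.
-- Then #Y_{l,n} = length R.
IsOrbitTransversal : (l n : ℕ) → List (Word l) → Set
IsOrbitTransversal l n R =
  All (HasRun n) R ×
  (∀ (u : Word l) → HasRun n u → ∃[ r ] (r ∈ R × SameOrbit r u)) ×
  AllPairs (λ r s → ¬ SameOrbit r s) R

-- n-step Lucas numbers. lucasList n m = [L_m, L_{m-1}, …, L_1].
lucasList : ℕ → ℕ → List ℕ
lucasList n zero    = []
lucasList n (suc m) with does (suc m ≤? n)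
... | true  = (2 ^ suc m ∸ 1) ∷ lucasList n m
... | false = sum (take n (lucasList n m)) ∷ lucasList n m

-- L^n_m  (meaningful for m ≥ 1); L^0_m = 0.
L : ℕ → ℕ → ℕ
L zero    m = 0
L (suc n) m with lucasList (suc n) m
... | []    = 0
... | x ∷ _ = x

φ : ℕ → ℕ
φ k = length (filter (λ i → gcd (suc i) k ≟ 1) (upTo k))

divisors : ℕ → List ℕ
divisors l = filter (λ m → m ∣? l) (map suc (upTo l))

orbitSum : (l n : ℕ) → .{{NonZero l}} → ℤ
orbitSum l n = go (divisors l)
  where
  go : List ℕ → ℤ
  go []       = + 0
  go (m ∷ ms) = (+ φ (l / suc (m ∸ 1))) ℤ.* (+ (2 ^ m) ℤ.- + L n m) ℤ.+ go ms

-- By Burnside's lemma, l · #Y_{l,n} is the number of pairs (i, u) with i < l, u ∈ X_{l,n} and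
-- shift i u ≡ u. A word fixed by shift i is fixed by shift (gcd i l), hence is the repetition of its
-- first gcd i l letters, and it has a run of n z's exactly when that prefix has one when read
-- cyclically. So shift i fixes 2 ^ g − C_n(g) words of X_{l,n}, where g = gcd i l and C_n(g) counts
-- the words of length g without a cyclic run of n z's; grouping the i < l by their gcd with l gives
-- φ(l / m) values of i for each divisor m. Finally C_n(m) = L^n_m: for m ≤ n only the all-z word has a
-- cyclic run, and for m > n, C_n(m) is the number of closed walks of length m of the automaton that
-- records the length of the current run of z's; splitting a closed walk at its first y expresses it
-- through compositions of m into parts of size at most n, which obey the n-step recurrence.

module Submission where

open import Level using (Level)
open import Data.Bool using (Bool; true; false; T)
import Data.Bool.Properties as Bool
open import Data.Empty using (⊥; ⊥-elim)
open import Data.Fin using (Fin; toℕ; fromℕ<)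
import Data.Fin.Properties as Finₚ
open import Data.Integer as ℤ using (ℤ)
open import Data.Integer.Properties using (pos-+; pos-*)
import Data.Integer.Tactic.RingSolver as ℤ-Solver
open import Data.List using (List; []; _∷_; _++_; map; length; filter; foldl; take; upTo)
open import Data.List.Properties using (length-++; length-map; map-upTo; length-upTo)
open import Data.List.Membership.Propositional using (_∈_)
open import Data.List.Membership.Propositional.Properties using (∈-upTo⁻)
open import Data.List.Relation.Unary.All using (All; []; _∷_)
import Data.List.Relation.Unary.All as All
open import Data.List.Relation.Unary.AllPairs using (AllPairs; []; _∷_)
open import Data.List.Relation.Unary.Any using (Any; here; there; any?)
import Data.List.Relation.Unary.Any as Any
open import Data.Maybe using (Maybe; just; nothing)
import Data.Maybe.Properties as Maybe
open import Data.Nat using (ℕ; zero; suc; _+_; _*_; _∸_; _^_; _<_; _≤_; z≤n; s≤s; _%_; _/_; _<ᵇ_; anyUpTo?; allUpTo?)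
open import Data.Nat.Properties
open import Algebra.Properties.CommutativeSemigroup +-commutativeSemigroup using () renaming (interchange to +-interchange)
open import Data.Nat.DivMod
open import Data.Nat.Divisibility using (_∣_; _∣?_; divides; ∣m+n∣m⇒∣n; n∣m*n; ∣⇒≤)
open import Data.Nat.GCD
open import Data.Nat.ListAction using (sum)
open import Data.Nat.Tactic.RingSolver using (solve-∀)
open import Data.Product using (_×_; _,_; proj₁; proj₂; ∃-syntax)
open import Data.Sum using (inj₁; inj₂)
open import Data.Vec using (Vec; []; _∷_; _∷ʳ_; lookup)
import Data.Vec.Properties as Vec
open import Function using (_∘_)
open import Relation.Binary.Definitions using (DecidableEquality; tri<; tri≈; tri>)
open import Relation.Binary.PropositionalEquality
open import Relation.Nullary using (¬_; Dec; yes; no; ¬?)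
open import Relation.Nullary.Decidable using (_×-dec_)
open import Relation.Unary using (Pred; Decidable)

open import Defs

private
  variable
    ℓ₁ ℓ₂ ℓ₃ : Level
    A : Set ℓ₁
    B : Set ℓ₂
    P : Set ℓ₃

-- Indicators and finite sums

⟦_⟧ : Dec P → ℕ
⟦ yes _ ⟧ = 1
⟦ no _ ⟧ = 0

⟦⟧-yes : (d : Dec P) → P → ⟦ d ⟧ ≡ 1
⟦⟧-yes (yes _) _ = refl
⟦⟧-yes (no ¬p) p = ⊥-elim (¬p p)

⟦⟧-no : (d : Dec P) → ¬ P → ⟦ d ⟧ ≡ 0
⟦⟧-no (yes p) ¬p = ⊥-elim (¬p p)
⟦⟧-no (no _) _ = refl

⟦⟧-cong : ∀ {ℓ} {Q : Set ℓ} (d : Dec P) (e : Dec Q) → (P → Q) → (Q → P) → ⟦ d ⟧ ≡ ⟦ e ⟧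
⟦⟧-cong (yes p) e to _ = sym (⟦⟧-yes e (to p))
⟦⟧-cong (no ¬p) e _ from = sym (⟦⟧-no e (¬p ∘ from))

⟦⟧+⟦¬⟧≡1 : (d : Dec P) → ⟦ d ⟧ + ⟦ ¬? d ⟧ ≡ 1
⟦⟧+⟦¬⟧≡1 (yes _) = refl
⟦⟧+⟦¬⟧≡1 (no _) = refl

⟦⟧*-cong : (d : Dec P) {x y : ℕ} → (P → x ≡ y) → ⟦ d ⟧ * x ≡ ⟦ d ⟧ * y
⟦⟧*-cong (yes p) x≡y = cong (1 *_) (x≡y p)
⟦⟧*-cong (no _) _ = refl

∑ : List A → (A → ℕ) → ℕ
∑ [] f = 0
∑ (x ∷ xs) f = f x + ∑ xs f

∑-cong-∈ : ∀ (xs : List A) {f g : A → ℕ} → (∀ x → x ∈ xs → f x ≡ g x) → ∑ xs f ≡ ∑ xs g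
∑-cong-∈ [] _ = refl
∑-cong-∈ (x ∷ xs) f≡g = cong₂ _+_ (f≡g x (here refl)) (∑-cong-∈ xs (λ y → f≡g y ∘ there))

∑-cong : ∀ (xs : List A) {f g : A → ℕ} → (∀ x → f x ≡ g x) → ∑ xs f ≡ ∑ xs g
∑-cong xs f≡g = ∑-cong-∈ xs (λ x _ → f≡g x)

∑-zero : ∀ (xs : List A) {f : A → ℕ} → (∀ x → x ∈ xs → f x ≡ 0) → ∑ xs f ≡ 0
∑-zero xs f≡0 = trans (∑-cong-∈ xs f≡0) (zeros xs)
  where
  zeros : ∀ xs → ∑ xs (λ _ → 0) ≡ 0
  zeros [] = refl
  zeros (_ ∷ xs) = zeros xs

∑-+ : ∀ (xs : List A) (f g : A → ℕ) → ∑ xs (λ x → f x + g x) ≡ ∑ xs f + ∑ xs g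
∑-+ [] f g = refl
∑-+ (x ∷ xs) f g = trans (cong (f x + g x +_) (∑-+ xs f g)) (+-interchange (f x) (g x) _ _)

∑-*ˡ : ∀ (xs : List A) (c : ℕ) (f : A → ℕ) → ∑ xs (λ x → c * f x) ≡ c * ∑ xs f
∑-*ˡ [] c f = sym (*-zeroʳ c)
∑-*ˡ (x ∷ xs) c f = trans (cong (c * f x +_) (∑-*ˡ xs c f)) (sym (*-distribˡ-+ c (f x) _))

∑-*ʳ : ∀ (xs : List A) (c : ℕ) (f : A → ℕ) → ∑ xs (λ x → f x * c) ≡ ∑ xs f * c
∑-*ʳ xs c f = trans (∑-cong xs (λ x → *-comm (f x) c)) (trans (∑-*ˡ xs c f) (*-comm c _))

∑-++ : ∀ (xs ys : List A) (f : A → ℕ) → ∑ (xs ++ ys) f ≡ ∑ xs f + ∑ ys f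
∑-++ [] ys f = refl
∑-++ (x ∷ xs) ys f = trans (cong (f x +_) (∑-++ xs ys f)) (sym (+-assoc (f x) _ _))

∑-const : ∀ (xs : List A) (c : ℕ) → ∑ xs (λ _ → c) ≡ length xs * c
∑-const [] c = refl
∑-const (_ ∷ xs) c = cong (c +_) (∑-const xs c)

∑-map : ∀ (g : A → B) (xs : List A) (f : B → ℕ) → ∑ (map g xs) f ≡ ∑ xs (f ∘ g)
∑-map g [] f = refl
∑-map g (x ∷ xs) f = cong (f (g x) +_) (∑-map g xs f)

∑-swap : ∀ (xs : List A) (ys : List B) (f : A → B → ℕ) →
  ∑ xs (λ x → ∑ ys (f x)) ≡ ∑ ys (λ y → ∑ xs (λ x → f x y))
∑-swap [] ys f = sym (∑-zero ys (λ _ _ → refl))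
∑-swap (x ∷ xs) ys f = trans (cong (∑ ys (f x) +_) (∑-swap xs ys f)) (sym (∑-+ ys (f x) _))

∑-filter : ∀ {ℓ} {P : Pred A ℓ} (P? : Decidable P) (xs : List A) (f : A → ℕ) →
  ∑ (filter P? xs) f ≡ ∑ xs (λ x → ⟦ P? x ⟧ * f x)
∑-filter P? [] f = refl
∑-filter P? (x ∷ xs) f with P? x
... | yes _ = cong₂ _+_ (sym (+-identityʳ (f x))) (∑-filter P? xs f)
... | no _ = ∑-filter P? xs f

length-filter : ∀ {ℓ} {P : Pred A ℓ} (P? : Decidable P) (xs : List A) → length (filter P? xs) ≡ ∑ xs (λ x → ⟦ P? x ⟧)
length-filter P? [] = refl
length-filter P? (x ∷ xs) with P? x
... | yes _ = cong suc (length-filter P? xs)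
... | no _ = length-filter P? xs

∑-⟦⟧+∑-⟦¬⟧ : ∀ {ℓ} {P : Pred A ℓ} (P? : Decidable P) (xs : List A) →
  ∑ xs (λ x → ⟦ P? x ⟧) + ∑ xs (λ x → ⟦ ¬? (P? x) ⟧) ≡ length xs
∑-⟦⟧+∑-⟦¬⟧ P? xs = begin
  ∑ xs (λ x → ⟦ P? x ⟧) + ∑ xs (λ x → ⟦ ¬? (P? x) ⟧) ≡⟨ ∑-+ xs _ _ ⟨
  ∑ xs (λ x → ⟦ P? x ⟧ + ⟦ ¬? (P? x) ⟧)              ≡⟨ ∑-cong xs (⟦⟧+⟦¬⟧≡1 ∘ P?) ⟩
  ∑ xs (λ _ → 1)                                      ≡⟨ ∑-const xs 1 ⟩
  length xs * 1                                       ≡⟨ *-identityʳ _ ⟩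
  length xs                                           ∎
  where open ≡-Reasoning

∑< : ℕ → (ℕ → ℕ) → ℕ
∑< m f = ∑ (upTo m) f

∑<-suc : ∀ m f → ∑< (suc m) f ≡ f 0 + ∑< m (f ∘ suc)
∑<-suc m f = cong (f 0 +_) (trans (cong (λ xs → ∑ xs f) (sym (map-upTo suc m))) (∑-map suc (upTo m) f))

∑<-cong : ∀ m {f g : ℕ → ℕ} → (∀ i → i < m → f i ≡ g i) → ∑< m f ≡ ∑< m g
∑<-cong m f≡g = ∑-cong-∈ (upTo m) (λ i i∈ → f≡g i (∈-upTo⁻ i∈))

∑<-zero : ∀ m {f : ℕ → ℕ} → (∀ i → i < m → f i ≡ 0) → ∑< m f ≡ 0
∑<-zero m f≡0 = ∑-zero (upTo m) (λ i i∈ → f≡0 i (∈-upTo⁻ i∈))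

∑<-const : ∀ m c → ∑< m (λ _ → c) ≡ m * c
∑<-const m c = trans (∑-const (upTo m) c) (cong (_* c) (length-upTo m))

∑<-+ : ∀ a b f → ∑< (a + b) f ≡ ∑< a f + ∑< b (λ j → f (a + j))
∑<-+ zero b f = refl
∑<-+ (suc a) b f = begin
  ∑< (suc a + b) f                                     ≡⟨ ∑<-suc (a + b) f ⟩
  f 0 + ∑< (a + b) (f ∘ suc)                           ≡⟨ cong (f 0 +_) (∑<-+ a b (f ∘ suc)) ⟩
  f 0 + (∑< a (f ∘ suc) + ∑< b (λ j → f (suc a + j)))  ≡⟨ +-assoc (f 0) _ _ ⟨
  f 0 + ∑< a (f ∘ suc) + ∑< b (λ j → f (suc a + j))    ≡⟨ cong (_+ ∑< b (λ j → f (suc a + j))) (∑<-suc a f) ⟨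
  ∑< (suc a) f + ∑< b (λ j → f (suc a + j))            ∎
  where open ≡-Reasoning

∑<-snoc : ∀ m f → ∑< (suc m) f ≡ ∑< m f + f m
∑<-snoc m f = begin
  ∑< (suc m) f                   ≡⟨ cong (λ k → ∑< k f) (+-comm 1 m) ⟩
  ∑< (m + 1) f                   ≡⟨ ∑<-+ m 1 f ⟩
  ∑< m f + (f (m + 0) + 0)       ≡⟨ cong (λ k → ∑< m f + k) (trans (+-identityʳ _) (cong f (+-identityʳ m))) ⟩
  ∑< m f + f m                   ∎
  where open ≡-Reasoning

∑<-pick : ∀ m r (f : ℕ → ℕ) → r < m → (∀ i → i < m → i ≢ r → f i ≡ 0) → ∑< m f ≡ f r
∑<-pick (suc m) zero f _ others = trans (∑<-suc m f)
  (trans (cong (f 0 +_) (∑<-zero m (λ i i<m → others (suc i) (s≤s i<m) (λ ())))) (+-identityʳ (f 0)))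
∑<-pick (suc m) (suc r) f (s≤s r<m) others = trans (∑<-suc m f)
  (cong₂ _+_ (others 0 (s≤s z≤n) (λ ())) (∑<-pick m r (f ∘ suc) r<m (λ i i<m i≢r → others (suc i) (s≤s i<m) (i≢r ∘ suc-injective))))

∑<-extend : ∀ a b (g : ℕ → ℕ) → (∀ j → a ≤ j → g j ≡ 0) → (∀ j → b ≤ j → g j ≡ 0) → ∑< a g ≡ ∑< b g
∑<-extend a b g ga gb with ≤-total a b
... | inj₁ a≤b with m≤n⇒∃[o]m+o≡n a≤b
... | e , refl = sym (trans (∑<-+ a e g) (trans (cong (∑< a g +_) (∑<-zero e (λ j _ → ga (a + j) (m≤m+n a j)))) (+-identityʳ _)))
∑<-extend a b g ga gb | inj₂ b≤a with m≤n⇒∃[o]m+o≡n b≤a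
... | e , refl = trans (∑<-+ b e g) (trans (cong (∑< b g +_) (∑<-zero e (λ j _ → gb (b + j) (m≤m+n b j)))) (+-identityʳ _))

∑<-rotate : ∀ l (F : ℕ → ℕ) → (∀ j → F (j + l) ≡ F j) → ∀ c → ∑< l (λ j → F (j + c)) ≡ ∑< l F
∑<-rotate l F periodic zero = ∑<-cong l (λ i _ → cong F (+-identityʳ i))
∑<-rotate l F periodic (suc c) = +-cancelʳ-≡ (F c) _ _ (begin
  ∑< l (λ j → F (j + suc c)) + F c   ≡⟨ cong (_+ F c) (∑<-cong l (λ j _ → cong F (+-suc j c))) ⟩
  ∑< l (λ j → F (suc j + c)) + F c   ≡⟨ +-comm _ (F c) ⟩
  F c + ∑< l (λ j → F (suc j + c))   ≡⟨ ∑<-suc l (λ j → F (j + c)) ⟨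
  ∑< (suc l) (λ j → F (j + c))       ≡⟨ ∑<-snoc l (λ j → F (j + c)) ⟩
  ∑< l (λ j → F (j + c)) + F (l + c) ≡⟨ cong₂ _+_ (∑<-rotate l F periodic c) (trans (cong F (+-comm l c)) (periodic c)) ⟩
  ∑< l F + F c                       ∎)
  where open ≡-Reasoning

∑<-blocks : ∀ k d (G : ℕ → ℕ) → ∑< (k * d) G ≡ ∑< k (λ q → ∑< d (λ r → G (q * d + r)))
∑<-blocks zero d G = refl
∑<-blocks (suc k) d G = begin
  ∑< (d + k * d) G                                          ≡⟨ ∑<-+ d (k * d) G ⟩
  ∑< d G + ∑< (k * d) (λ j → G (d + j))                     ≡⟨ cong (∑< d G +_) (∑<-blocks k d (λ j → G (d + j))) ⟩
  ∑< d G + ∑< k (λ q → ∑< d (λ r → G (d + (q * d + r))))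
    ≡⟨ cong (∑< d G +_) (∑<-cong k (λ q _ → ∑<-cong d (λ r _ → cong G (sym (+-assoc d (q * d) r))))) ⟩
  ∑< d G + ∑< k (λ q → ∑< d (λ r → G (suc q * d + r)))      ≡⟨ ∑<-suc k (λ q → ∑< d (λ r → G (q * d + r))) ⟨
  ∑< (suc k) (λ q → ∑< d (λ r → G (q * d + r)))             ∎
  where open ≡-Reasoning

module Enumeration {a} {A : Set a} (_≟_ : DecidableEquality A) where

  Enumerates : List A → Set a
  Enumerates xs = ∀ x → ∑ xs (λ y → ⟦ y ≟ x ⟧) ≡ 1

  ∑-pick : ∀ xs → Enumerates xs → ∀ x (g : A → ℕ) → ∑ xs (λ y → ⟦ y ≟ x ⟧ * g y) ≡ g x
  ∑-pick xs enum x g = begin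
    ∑ xs (λ y → ⟦ y ≟ x ⟧ * g y) ≡⟨ ∑-cong xs at-x ⟩
    ∑ xs (λ y → ⟦ y ≟ x ⟧ * g x) ≡⟨ ∑-*ʳ xs (g x) _ ⟩
    ∑ xs (λ y → ⟦ y ≟ x ⟧) * g x ≡⟨ cong (_* g x) (enum x) ⟩
    1 * g x                      ≡⟨ *-identityˡ (g x) ⟩
    g x                          ∎
    where
    open ≡-Reasoning
    at-x : ∀ y → ⟦ y ≟ x ⟧ * g y ≡ ⟦ y ≟ x ⟧ * g x
    at-x y = ⟦⟧*-cong (y ≟ x) (cong g)

  ∑-⟦≟⟧ : ∀ xs → Enumerates xs → ∀ x → ∑ xs (λ y → ⟦ x ≟ y ⟧) ≡ 1
  ∑-⟦≟⟧ xs enum x = trans (∑-cong xs (λ y → ⟦⟧-cong (x ≟ y) (y ≟ x) sym sym)) (enum x)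

  ∈-enumeration : ∀ xs → Enumerates xs → ∀ x → x ∈ xs
  ∈-enumeration xs enum x = go xs (enum x)
    where
    go : ∀ ys → ∑ ys (λ y → ⟦ y ≟ x ⟧) ≡ 1 → x ∈ ys
    go (y ∷ ys) count with y ≟ x
    ... | yes refl = here refl
    ... | no _ = there (go ys count)

module Bijection {a b} {A : Set a} {B : Set b} (_≟A_ : DecidableEquality A) (_≟B_ : DecidableEquality B)
  (xs : List A) (ys : List B)
  (enumA : Enumeration.Enumerates _≟A_ xs) (enumB : Enumeration.Enumerates _≟B_ ys)
  {p q} {P : Pred A p} {Q : Pred B q} (P? : Decidable P) (Q? : Decidable Q)
  (f : A → B) (g : B → A)
  (f-resp : ∀ x → P x → Q (f x)) (g-resp : ∀ y → Q y → P (g y))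
  (g∘f : ∀ x → P x → g (f x) ≡ x) (f∘g : ∀ y → Q y → f (g y) ≡ y) where

  private
    graph : ∀ x y → ⟦ y ≟B f x ⟧ * ⟦ P? x ⟧ ≡ ⟦ x ≟A g y ⟧ * ⟦ Q? y ⟧
    graph x y with P? x | Q? y
    ... | yes px | yes qy = cong (_* 1) (⟦⟧-cong (y ≟B f x) (x ≟A g y)
      (λ y≡fx → trans (sym (g∘f x px)) (cong g (sym y≡fx))) (λ x≡gy → trans (sym (f∘g y qy)) (cong f (sym x≡gy))))
    ... | yes px | no ¬qy = trans (cong (_* 1) (⟦⟧-no (y ≟B f x) (λ y≡fx → ¬qy (subst Q (sym y≡fx) (f-resp x px)))))
      (sym (*-zeroʳ ⟦ x ≟A g y ⟧))
    ... | no ¬px | yes qy = trans (*-zeroʳ ⟦ y ≟B f x ⟧)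
      (sym (cong (_* 1) (⟦⟧-no (x ≟A g y) (λ x≡gy → ¬px (subst P (sym x≡gy) (g-resp y qy))))))
    ... | no _ | no _ = trans (*-zeroʳ ⟦ y ≟B f x ⟧) (sym (*-zeroʳ ⟦ x ≟A g y ⟧))

  count-bijection : ∑ xs (λ x → ⟦ P? x ⟧) ≡ ∑ ys (λ y → ⟦ Q? y ⟧)
  count-bijection = begin
    ∑ xs (λ x → ⟦ P? x ⟧)                                ≡⟨ ∑-cong xs (λ x → Enumeration.∑-pick _≟B_ ys enumB (f x) (λ _ → ⟦ P? x ⟧)) ⟨
    ∑ xs (λ x → ∑ ys (λ y → ⟦ y ≟B f x ⟧ * ⟦ P? x ⟧))    ≡⟨ ∑-cong xs (λ x → ∑-cong ys (graph x)) ⟩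
    ∑ xs (λ x → ∑ ys (λ y → ⟦ x ≟A g y ⟧ * ⟦ Q? y ⟧))    ≡⟨ ∑-swap xs ys _ ⟩
    ∑ ys (λ y → ∑ xs (λ x → ⟦ x ≟A g y ⟧ * ⟦ Q? y ⟧))    ≡⟨ ∑-cong ys (λ y → Enumeration.∑-pick _≟A_ xs enumA (g y) (λ _ → ⟦ Q? y ⟧)) ⟩
    ∑ ys (λ y → ⟦ Q? y ⟧)                                ∎
    where open ≡-Reasoning

-- Binary words read cyclically

words : (m : ℕ) → List (Vec Bool m)
words zero = [] ∷ []
words (suc m) = map (true ∷_) (words m) ++ map (false ∷_) (words m)

_≟ᵛ_ : ∀ {m} → DecidableEquality (Vec Bool m)
_≟ᵛ_ = Vec.≡-dec Bool._≟_

words-enumerates : ∀ m → Enumeration.Enumerates _≟ᵛ_ (words m)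
words-enumerates zero [] = refl
words-enumerates (suc m) (b ∷ v) = begin
  ∑ (map (true ∷_) (words m) ++ map (false ∷_) (words m)) (λ y → ⟦ y ≟ᵛ (b ∷ v) ⟧)
    ≡⟨ ∑-++ (map (true ∷_) (words m)) _ _ ⟩
  ∑ (map (true ∷_) (words m)) (λ y → ⟦ y ≟ᵛ (b ∷ v) ⟧) + ∑ (map (false ∷_) (words m)) (λ y → ⟦ y ≟ᵛ (b ∷ v) ⟧)
    ≡⟨ cong₂ _+_ (∑-map (true ∷_) (words m) _) (∑-map (false ∷_) (words m) _) ⟩
  ∑ (words m) (λ u → ⟦ (true ∷ u) ≟ᵛ (b ∷ v) ⟧) + ∑ (words m) (λ u → ⟦ (false ∷ u) ≟ᵛ (b ∷ v) ⟧)
    ≡⟨ by-head b ⟩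
  1 ∎
  where
  open ≡-Reasoning
  same-head : ∀ c → ∑ (words m) (λ u → ⟦ (c ∷ u) ≟ᵛ (c ∷ v) ⟧) ≡ 1
  same-head c = trans (∑-cong (words m) (λ u → ⟦⟧-cong ((c ∷ u) ≟ᵛ (c ∷ v)) (u ≟ᵛ v) Vec.∷-injectiveʳ (cong (c ∷_))))
                      (words-enumerates m v)
  other-head : ∀ c d → c ≢ d → ∑ (words m) (λ u → ⟦ (c ∷ u) ≟ᵛ (d ∷ v) ⟧) ≡ 0
  other-head c d c≢d = ∑-zero (words m) (λ u _ → ⟦⟧-no ((c ∷ u) ≟ᵛ (d ∷ v)) (c≢d ∘ Vec.∷-injectiveˡ))
  by-head : ∀ b → ∑ (words m) (λ u → ⟦ (true ∷ u) ≟ᵛ (b ∷ v) ⟧) + ∑ (words m) (λ u → ⟦ (false ∷ u) ≟ᵛ (b ∷ v) ⟧) ≡ 1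
  by-head true = cong₂ _+_ (same-head true) (other-head false true (λ ()))
  by-head false = cong₂ _+_ (other-head true false (λ ())) (same-head false)

length-words : ∀ m → length (words m) ≡ 2 ^ m
length-words zero = refl
length-words (suc m) = begin
  length (map (true ∷_) (words m) ++ map (false ∷_) (words m)) ≡⟨ length-++ (map (true ∷_) (words m)) ⟩
  length (map (true ∷_) (words m)) + length (map (false ∷_) (words m))
    ≡⟨ cong₂ _+_ (length-map _ (words m)) (length-map _ (words m)) ⟩
  length (words m) + length (words m) ≡⟨ cong₂ _+_ (length-words m) (trans (length-words m) (sym (+-identityʳ _))) ⟩
  2 ^ m + (2 ^ m + 0) ∎
  where open ≡-Reasoning

lookupℕ : ∀ {m} → Vec Bool m → ℕ → Bool
lookupℕ [] _ = false
lookupℕ (x ∷ xs) zero = x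
lookupℕ (x ∷ xs) (suc i) = lookupℕ xs i

lookup≡lookupℕ : ∀ {m} (v : Vec Bool m) (k : Fin m) → lookup v k ≡ lookupℕ v (toℕ k)
lookup≡lookupℕ (x ∷ v) Fin.zero = refl
lookup≡lookupℕ (x ∷ v) (Fin.suc k) = lookup≡lookupℕ v k

lookupℕ-∷ʳ-< : ∀ {m} (xs : Vec Bool m) x i → i < m → lookupℕ (xs ∷ʳ x) i ≡ lookupℕ xs i
lookupℕ-∷ʳ-< (y ∷ xs) x zero _ = refl
lookupℕ-∷ʳ-< (y ∷ xs) x (suc i) (s≤s i<m) = lookupℕ-∷ʳ-< xs x i i<m

lookupℕ-∷ʳ-last : ∀ {m} (xs : Vec Bool m) x → lookupℕ (xs ∷ʳ x) m ≡ x
lookupℕ-∷ʳ-last [] x = refl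
lookupℕ-∷ʳ-last (y ∷ xs) x = lookupℕ-∷ʳ-last xs x

lookupℕ-ext : ∀ {m} (u v : Vec Bool m) → (∀ i → i < m → lookupℕ u i ≡ lookupℕ v i) → u ≡ v
lookupℕ-ext [] [] _ = refl
lookupℕ-ext (x ∷ u) (y ∷ v) u≗v = cong₂ _∷_ (u≗v 0 (s≤s z≤n)) (lookupℕ-ext u v (λ i i<m → u≗v (suc i) (s≤s i<m)))

cyclic : ∀ {m} → Vec Bool (suc m) → ℕ → Bool
cyclic {m} v t = lookupℕ v (t % suc m)

cyclic-< : ∀ {m} (v : Vec Bool (suc m)) t → t < suc m → cyclic v t ≡ lookupℕ v t
cyclic-< v t t<l = cong (lookupℕ v) (m<n⇒m%n≡m t<l)

cyclic-ext : ∀ {m} (u v : Vec Bool (suc m)) → (∀ t → t < suc m → cyclic u t ≡ cyclic v t) → u ≡ v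
cyclic-ext u v u≗v = lookupℕ-ext u v (λ i i<l → trans (sym (cyclic-< u i i<l)) (trans (u≗v i i<l) (cyclic-< v i i<l)))

cyclic-% : ∀ {m} (v : Vec Bool (suc m)) t → cyclic v (t % suc m) ≡ cyclic v t
cyclic-% {m} v t = cong (lookupℕ v) (m%n%n≡m%n t (suc m))

cyclic-periodic : ∀ {m} (v : Vec Bool (suc m)) c t → cyclic v (t + c * suc m) ≡ cyclic v t
cyclic-periodic {m} v c t = cong (lookupℕ v) ([m+kn]%n≡m%n t c (suc m))

cyclic-+length : ∀ {m} (v : Vec Bool (suc m)) t → cyclic v (suc m + t) ≡ cyclic v t
cyclic-+length {m} v t = trans (cong (cyclic v) (trans (+-comm (suc m) t) (cong (t +_) (sym (*-identityˡ (suc m))))))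
                               (cyclic-periodic v 1 t)

cyclic-rot : ∀ {m} (v : Vec Bool (suc m)) t → cyclic (rot v) t ≡ cyclic v (suc t)
cyclic-rot {m} (x ∷ xs) t = trans (rotated (t % suc m) (m%n<n t (suc m))) (cong (lookupℕ (x ∷ xs)) (sym suc-%))
  where
  suc-% : suc t % suc m ≡ suc (t % suc m) % suc m
  suc-% = trans (cong (λ z → suc z % suc m) (m≡m%n+[m/n]*n t (suc m))) ([m+kn]%n≡m%n (suc (t % suc m)) (t / suc m) (suc m))
  rotated : ∀ r → r < suc m → lookupℕ (xs ∷ʳ x) r ≡ lookupℕ (x ∷ xs) (suc r % suc m)
  rotated r (s≤s r≤m) with m≤n⇒m<n∨m≡n r≤m
  ... | inj₁ r<m = trans (lookupℕ-∷ʳ-< xs x r r<m) (cong (lookupℕ (x ∷ xs)) (sym (m<n⇒m%n≡m (s≤s r<m))))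
  ... | inj₂ refl = trans (lookupℕ-∷ʳ-last xs x) (cong (lookupℕ (x ∷ xs)) (sym (n%n≡0 (suc m))))

cyclic-shift : ∀ {m} (v : Vec Bool (suc m)) j t → cyclic (shift j v) t ≡ cyclic v (j + t)
cyclic-shift v zero t = refl
cyclic-shift v (suc j) t = trans (cyclic-rot (shift j v) t) (trans (cyclic-shift v j (suc t)) (cong (cyclic v) (+-suc j t)))

shift-+ : ∀ {l} a b (u : Word l) → shift (a + b) u ≡ shift a (shift b u)
shift-+ zero b u = refl
shift-+ (suc a) b u = cong rot (shift-+ a b u)

shift-length : ∀ {m} (u : Word (suc m)) → shift (suc m) u ≡ u
shift-length {m} u = cyclic-ext _ u (λ t _ → trans (cyclic-shift u (suc m) t) (cyclic-+length u t))

shift-*-period : ∀ {l} p c (u : Word l) → shift p u ≡ u → shift (c * p) u ≡ u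
shift-*-period p zero u _ = refl
shift-*-period p (suc c) u period = trans (shift-+ p (c * p) u) (trans (cong (shift p) (shift-*-period p c u period)) period)

shift-*-length : ∀ {m} c (u : Word (suc m)) → shift (c * suc m) u ≡ u
shift-*-length {m} c u = shift-*-period (suc m) c u (shift-length u)

shift-% : ∀ {m} j (u : Word (suc m)) → shift (j % suc m) u ≡ shift j u
shift-% {m} j u = sym (begin
  shift j u                                    ≡⟨ cong (λ z → shift z u) (m≡m%n+[m/n]*n j (suc m)) ⟩
  shift (j % suc m + j / suc m * suc m) u      ≡⟨ shift-+ (j % suc m) _ u ⟩
  shift (j % suc m) (shift (j / suc m * suc m) u) ≡⟨ cong (shift (j % suc m)) (shift-*-length (j / suc m) u) ⟩
  shift (j % suc m) u                          ∎)
  where open ≡-Reasoning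

-- Cyclic runs and orbits

Window : ℕ → (ℕ → Bool) → ℕ → Set
Window n f a = ∀ {k} → k < n → f (a + k) ≡ true

window? : ∀ n f a → Dec (Window n f a)
window? n f a = allUpTo? (λ k → f (a + k) Bool.≟ true) n

-- Unlike HasRun, this allows n beyond the length of the word (the window then wraps around
-- several times), as needed for the words of length gcd i l that describe fixed points of shifts.
HasCyclicRun : ∀ {m} → ℕ → Vec Bool (suc m) → Set
HasCyclicRun {m} n u = ∃[ j ] (j < suc m × Window n (cyclic u) j)

hasCyclicRun? : ∀ {m} n (u : Vec Bool (suc m)) → Dec (HasCyclicRun n u)
hasCyclicRun? {m} n u = anyUpTo? (window? n (cyclic u)) (suc m)

window⇒hasCyclicRun : ∀ {m} n (u : Vec Bool (suc m)) a → Window n (cyclic u) a → HasCyclicRun n u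
window⇒hasCyclicRun {m} n u a w = a % suc m , m%n<n a (suc m) , λ {k} k<n → trans (reduce k) (w k<n)
  where
  reduce : ∀ k → cyclic u (a % suc m + k) ≡ cyclic u (a + k)
  reduce k = begin
    cyclic u (a % suc m + k)                      ≡⟨ cyclic-periodic u (a / suc m) (a % suc m + k) ⟨
    cyclic u (a % suc m + k + a / suc m * suc m)  ≡⟨ cong (cyclic u) (regroup (a % suc m) k (a / suc m * suc m)) ⟩
    cyclic u (a % suc m + a / suc m * suc m + k)  ≡⟨ cong (λ z → cyclic u (z + k)) (m≡m%n+[m/n]*n a (suc m)) ⟨
    cyclic u (a + k)                              ∎
    where
    open ≡-Reasoning
    regroup : ∀ x y z → x + y + z ≡ x + z + y
    regroup = solve-∀

hasCyclicRun-shift : ∀ {m} n i (u : Vec Bool (suc m)) → HasCyclicRun n u → HasCyclicRun n (shift i u)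
hasCyclicRun-shift {m} n i u (j , _ , w) = window⇒hasCyclicRun n (shift i u) (j + m * i) (λ {k} k<n → begin
  cyclic (shift i u) (j + m * i + k) ≡⟨ cyclic-shift u i _ ⟩
  cyclic u (i + (j + m * i + k))     ≡⟨ cong (cyclic u) (wrap i j m k) ⟩
  cyclic u (j + k + i * suc m)       ≡⟨ cyclic-periodic u i (j + k) ⟩
  cyclic u (j + k)                   ≡⟨ w k<n ⟩
  true                               ∎)
  where
  open ≡-Reasoning
  wrap : ∀ i j m k → i + (j + m * i + k) ≡ j + k + i * suc m
  wrap = solve-∀

hasRun⇒hasCyclicRun : ∀ {m} n (u : Word (suc m)) → n ≤ suc m → HasRun n u → HasCyclicRun n u
hasRun⇒hasCyclicRun {m} n u n≤l (j , j<l , run) = j , j<l , λ {k} k<n →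
  let k<l = ≤-trans k<n n≤l
      k′ = fromℕ< k<l
      toℕ-k′ = Finₚ.toℕ-fromℕ< k<l
  in begin
    cyclic u (j + k)                ≡⟨ cyclic-shift u j k ⟨
    cyclic (shift j u) k            ≡⟨ cong (cyclic (shift j u)) toℕ-k′ ⟨
    cyclic (shift j u) (toℕ k′)     ≡⟨ cyclic-< (shift j u) (toℕ k′) (Finₚ.toℕ<n k′) ⟩
    lookupℕ (shift j u) (toℕ k′)    ≡⟨ lookup≡lookupℕ (shift j u) k′ ⟨
    lookup (shift j u) k′           ≡⟨ run k′ (subst (_< n) (sym toℕ-k′) k<n) ⟩
    true                            ∎
  where open ≡-Reasoning

hasCyclicRun⇒hasRun : ∀ {m} n (u : Word (suc m)) → HasCyclicRun n u → HasRun n u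
hasCyclicRun⇒hasRun {m} n u (j , j<l , w) = j , j<l , λ k k<n → begin
  lookup (shift j u) k                ≡⟨ lookup≡lookupℕ (shift j u) k ⟩
  lookupℕ (shift j u) (toℕ k)         ≡⟨ cyclic-< (shift j u) (toℕ k) (Finₚ.toℕ<n k) ⟨
  cyclic (shift j u) (toℕ k)          ≡⟨ cyclic-shift u j (toℕ k) ⟩
  cyclic u (j + toℕ k)                ≡⟨ w k<n ⟩
  true                                ∎
  where open ≡-Reasoning

hasRun? : ∀ {m} n (u : Word (suc m)) → n ≤ suc m → Dec (HasRun n u)
hasRun? n u n≤l with hasCyclicRun? n u
... | yes run = yes (hasCyclicRun⇒hasRun n u run)
... | no ¬run = no (¬run ∘ hasRun⇒hasCyclicRun n u n≤l)

module _ {m : ℕ} where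

  sameOrbit-refl : (u : Word (suc m)) → SameOrbit u u
  sameOrbit-refl u = 0 , s≤s z≤n , refl

  sameOrbit-trans : {r s t : Word (suc m)} → SameOrbit r s → SameOrbit s t → SameOrbit r t
  sameOrbit-trans {r} (j , _ , refl) (j′ , _ , refl) =
    (j′ + j) % suc m , m%n<n (j′ + j) (suc m) , trans (shift-% (j′ + j) r) (shift-+ j′ j r)

  sameOrbit-sym : {r s : Word (suc m)} → SameOrbit r s → SameOrbit s r
  sameOrbit-sym {r} (j , _ , refl) = (m * j) % suc m , m%n<n (m * j) (suc m) , (begin
    shift (m * j % suc m) (shift j r) ≡⟨ shift-% (m * j) (shift j r) ⟩
    shift (m * j) (shift j r)         ≡⟨ shift-+ (m * j) j r ⟨
    shift (m * j + j) r               ≡⟨ cong (λ z → shift z r) (full-turns m j) ⟩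
    shift (j * suc m) r               ≡⟨ shift-*-length j r ⟩
    r                                 ∎)
    where
    open ≡-Reasoning
    full-turns : ∀ m j → m * j + j ≡ j * suc m
    full-turns = solve-∀

  sameOrbit? : (r s : Word (suc m)) → Dec (SameOrbit r s)
  sameOrbit? r s = anyUpTo? (λ j → shift j r ≟ᵛ s) (suc m)

  hasRun-sameOrbit : ∀ n {r s : Word (suc m)} → n ≤ suc m → SameOrbit r s → HasRun n r → HasRun n s
  hasRun-sameOrbit n {r} n≤l (j , _ , refl) =
    hasCyclicRun⇒hasRun n (shift j r) ∘ hasCyclicRun-shift n j r ∘ hasRun⇒hasCyclicRun n r n≤l

-- Orbit transversals and Burnside's lemma

module Transversal {m n : ℕ} (n≤l : n ≤ suc m) where

  private
    W = Word (suc m)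

  Covers : List W → W → Set
  Covers R u = ∃[ r ] (r ∈ R × SameOrbit r u)

  any⇒covers : ∀ {R : List W} {u} → Any (λ r → SameOrbit r u) R → Covers R u
  any⇒covers (here so) = _ , here refl , so
  any⇒covers (there a) with any⇒covers a
  ... | r , r∈ , so = r , there r∈ , so

  insert : List W → W → List W
  insert R u with hasRun? n u n≤l | any? (λ r → sameOrbit? r u) R
  ... | yes _ | no _ = u ∷ R
  ... | yes _ | yes _ = R
  ... | no _ | _ = R

  insert-hasRun : ∀ R u → All (HasRun n) R → All (HasRun n) (insert R u)
  insert-hasRun R u runs with hasRun? n u n≤l | any? (λ r → sameOrbit? r u) R
  ... | yes run | no _ = run ∷ runs
  ... | yes _ | yes _ = runs
  ... | no _ | _ = runs

  insert-distinct : ∀ R u → AllPairs (λ r s → ¬ SameOrbit r s) R → AllPairs (λ r s → ¬ SameOrbit r s) (insert R u)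
  insert-distinct R u distinct with hasRun? n u n≤l | any? (λ r → sameOrbit? r u) R
  ... | yes _ | no ¬covered = All.tabulate (λ r∈ so → ¬covered (Any.map (λ { refl → sameOrbit-sym so }) r∈)) ∷ distinct
  ... | yes _ | yes _ = distinct
  ... | no _ | _ = distinct

  insert-covers : ∀ R u v → Covers R v → Covers (insert R u) v
  insert-covers R u v (r , r∈ , so) with hasRun? n u n≤l | any? (λ r → sameOrbit? r u) R
  ... | yes _ | no _ = r , there r∈ , so
  ... | yes _ | yes _ = r , r∈ , so
  ... | no _ | _ = r , r∈ , so

  insert-covers-new : ∀ R u → HasRun n u → Covers (insert R u) u
  insert-covers-new R u run with hasRun? n u n≤l | any? (λ r → sameOrbit? r u) R
  ... | yes _ | no _ = u , here refl , sameOrbit-refl u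
  ... | yes _ | yes covered = any⇒covers covered
  ... | no ¬run | _ = ⊥-elim (¬run run)

  greedy : List W → List W → List W
  greedy = foldl insert

  greedy-hasRun : ∀ R us → All (HasRun n) R → All (HasRun n) (greedy R us)
  greedy-hasRun R [] runs = runs
  greedy-hasRun R (u ∷ us) runs = greedy-hasRun (insert R u) us (insert-hasRun R u runs)

  greedy-distinct : ∀ R us → AllPairs (λ r s → ¬ SameOrbit r s) R → AllPairs (λ r s → ¬ SameOrbit r s) (greedy R us)
  greedy-distinct R [] distinct = distinct
  greedy-distinct R (u ∷ us) distinct = greedy-distinct (insert R u) us (insert-distinct R u distinct)

  greedy-covers : ∀ R us v → Covers R v → Covers (greedy R us) v
  greedy-covers R [] v covered = covered
  greedy-covers R (u ∷ us) v covered = greedy-covers (insert R u) us v (insert-covers R u v covered)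

  greedy-covers-∈ : ∀ R us v → v ∈ us → HasRun n v → Covers (greedy R us) v
  greedy-covers-∈ R (u ∷ us) v (here refl) run = greedy-covers (insert R v) us v (insert-covers-new R v run)
  greedy-covers-∈ R (u ∷ us) v (there v∈) run = greedy-covers-∈ (insert R u) us v v∈ run

  transversal : ∃[ R ] IsOrbitTransversal (suc m) n R
  transversal = greedy [] (words (suc m)) ,
    greedy-hasRun [] (words (suc m)) [] ,
    (λ u → greedy-covers-∈ [] (words (suc m)) u (Enumeration.∈-enumeration _≟ᵛ_ (words (suc m)) (words-enumerates (suc m)) u)) ,
    greedy-distinct [] (words (suc m)) []

fixedWithRun : ∀ {m n} → n ≤ suc m → ℕ → ℕ
fixedWithRun {m} {n} n≤l i = ∑ (words (suc m)) (λ u → ⟦ hasRun? n u n≤l ⟧ * ⟦ shift i u ≟ᵛ u ⟧)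

module Burnside {m n : ℕ} (n≤l : n ≤ suc m) (R : List (Word (suc m))) (tr : IsOrbitTransversal (suc m) n R) where

  private
    l = suc m
    W = Word l

    runs : All (HasRun n) R
    runs = proj₁ tr

    covers : ∀ u → HasRun n u → ∃[ r ] (r ∈ R × SameOrbit r u)
    covers = proj₁ (proj₂ tr)

    distinct : AllPairs (λ r s → ¬ SameOrbit r s) R
    distinct = proj₂ (proj₂ tr)

  hits : W → W → ℕ
  hits r u = ∑< l (λ j → ⟦ shift j r ≟ᵛ u ⟧)

  fixers : W → ℕ
  fixers u = ∑< l (λ i → ⟦ shift i u ≟ᵛ u ⟧)

  ∑-hits : ∀ r → ∑ (words l) (hits r) ≡ l
  ∑-hits r = begin
    ∑ (words l) (λ u → ∑< l (λ j → ⟦ shift j r ≟ᵛ u ⟧)) ≡⟨ ∑-swap (words l) (upTo l) _ ⟩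
    ∑< l (λ j → ∑ (words l) (λ u → ⟦ shift j r ≟ᵛ u ⟧)) ≡⟨ ∑<-cong l (λ j _ → Enumeration.∑-⟦≟⟧ _≟ᵛ_ (words l) (words-enumerates l) (shift j r)) ⟩
    ∑< l (λ _ → 1)                                     ≡⟨ ∑<-const l 1 ⟩
    l * 1                                              ≡⟨ *-identityʳ l ⟩
    l                                                  ∎
    where open ≡-Reasoning

  hits-other-orbit : ∀ r u → ¬ SameOrbit r u → hits r u ≡ 0
  hits-other-orbit r u ¬so = ∑<-zero l (λ j j<l → ⟦⟧-no (shift j r ≟ᵛ u) (λ e → ¬so (j , j<l , e)))

  hits≡fixers : ∀ r u → SameOrbit r u → hits r u ≡ fixers u
  hits≡fixers r u (j₀ , _ , refl) = begin
    ∑< l F                                        ≡⟨ ∑<-rotate l F F-periodic j₀ ⟨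
    ∑< l (λ j → F (j + j₀))                       ≡⟨ ∑<-cong l (λ j _ → ⟦⟧-cong (shift (j + j₀) r ≟ᵛ shift j₀ r) (shift j (shift j₀ r) ≟ᵛ shift j₀ r)
                                                       (trans (sym (shift-+ j j₀ r))) (trans (shift-+ j j₀ r))) ⟩
    fixers (shift j₀ r)                           ∎
    where
    open ≡-Reasoning
    F : ℕ → ℕ
    F j = ⟦ shift j r ≟ᵛ shift j₀ r ⟧
    F-periodic : ∀ j → F (j + l) ≡ F j
    F-periodic j = cong (λ z → ⟦ z ≟ᵛ shift j₀ r ⟧) (trans (shift-+ j l r) (cong (shift j) (shift-length r)))

  ∑-hits-∈ : ∀ (S : List W) → AllPairs (λ r s → ¬ SameOrbit r s) S → ∀ r₀ u → r₀ ∈ S → SameOrbit r₀ u →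
    ∑ S (λ r → hits r u) ≡ hits r₀ u
  ∑-hits-∈ (r ∷ S) (r≁S ∷ _) r₀ u (here refl) so = trans
    (cong (hits r u +_) (∑-zero S (λ r′ r′∈ → hits-other-orbit r′ u (λ so′ → All.lookup r≁S r′∈ (sameOrbit-trans so (sameOrbit-sym so′))))))
    (+-identityʳ _)
  ∑-hits-∈ (r ∷ S) (r≁S ∷ distinct) r₀ u (there r₀∈) so = trans
    (cong (_+ ∑ S (λ r → hits r u)) (hits-other-orbit r u (λ so′ → All.lookup r≁S r₀∈ (sameOrbit-trans so′ (sameOrbit-sym so)))))
    (∑-hits-∈ S distinct r₀ u r₀∈ so)

  ∑-hits-R : ∀ u → ∑ R (λ r → hits r u) ≡ ⟦ hasRun? n u n≤l ⟧ * fixers u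
  ∑-hits-R u with hasRun? n u n≤l
  ... | no ¬run = ∑-zero R (λ r r∈ → hits-other-orbit r u (λ so → ¬run (hasRun-sameOrbit n n≤l so (All.lookup runs r∈))))
  ... | yes run with covers u run
  ... | r₀ , r₀∈ , so = trans (∑-hits-∈ R distinct r₀ u r₀∈ so) (trans (hits≡fixers r₀ u so) (sym (+-identityʳ _)))

  burnside : l * length R ≡ ∑< l (fixedWithRun n≤l)
  burnside = begin
    l * length R                                   ≡⟨ *-comm l (length R) ⟩
    length R * l                                   ≡⟨ ∑-const R l ⟨
    ∑ R (λ _ → l)                                  ≡⟨ ∑-cong R ∑-hits ⟨
    ∑ R (λ r → ∑ (words l) (hits r))               ≡⟨ ∑-swap R (words l) _ ⟩
    ∑ (words l) (λ u → ∑ R (λ r → hits r u))       ≡⟨ ∑-cong (words l) ∑-hits-R ⟩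
    ∑ (words l) (λ u → ⟦ hasRun? n u n≤l ⟧ * fixers u)
      ≡⟨ ∑-cong (words l) (λ u → ∑-*ˡ (upTo l) ⟦ hasRun? n u n≤l ⟧ _) ⟨
    ∑ (words l) (λ u → ∑< l (λ i → ⟦ hasRun? n u n≤l ⟧ * ⟦ shift i u ≟ᵛ u ⟧))
      ≡⟨ ∑-swap (words l) (upTo l) _ ⟩
    ∑< l (fixedWithRun n≤l)                        ∎
    where open ≡-Reasoning

-- Words fixed by a shift

tabulateℕ : (k : ℕ) → (ℕ → Bool) → Vec Bool k
tabulateℕ zero F = []
tabulateℕ (suc k) F = F 0 ∷ tabulateℕ k (F ∘ suc)

lookupℕ-tabulateℕ : ∀ k F i → i < k → lookupℕ (tabulateℕ k F) i ≡ F i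
lookupℕ-tabulateℕ (suc k) F zero _ = refl
lookupℕ-tabulateℕ (suc k) F (suc i) (s≤s i<k) = lookupℕ-tabulateℕ k (F ∘ suc) i i<k

cyclic-tabulateℕ : ∀ k F t → cyclic (tabulateℕ (suc k) F) t ≡ F (t % suc k)
cyclic-tabulateℕ k F t = lookupℕ-tabulateℕ (suc k) F (t % suc k) (m%n<n t (suc k))

shift-gcd⇒ : ∀ {m} i (u : Word (suc m)) → shift i u ≡ u → shift (gcd i (suc m)) u ≡ u
shift-gcd⇒ {m} i u fixed with Bézout.identity (gcd-GCD i (suc m))
... | Bézout.+- x y eq = begin
  shift g u                      ≡⟨ cong (shift g) (shift-*-length y u) ⟨
  shift g (shift (y * suc m) u)  ≡⟨ shift-+ g (y * suc m) u ⟨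
  shift (g + y * suc m) u        ≡⟨ cong (λ z → shift z u) eq ⟩
  shift (x * i) u                ≡⟨ shift-*-period i x u fixed ⟩
  u                              ∎
  where
  open ≡-Reasoning
  g = gcd i (suc m)
... | Bézout.-+ x y eq = begin
  shift g u                      ≡⟨ cong (shift g) (shift-*-period i x u fixed) ⟨
  shift g (shift (x * i) u)      ≡⟨ shift-+ g (x * i) u ⟨
  shift (g + x * i) u            ≡⟨ cong (λ z → shift z u) eq ⟩
  shift (y * suc m) u            ≡⟨ shift-*-length y u ⟩
  u                              ∎
  where
  open ≡-Reasoning
  g = gcd i (suc m)

shift-gcd⇐ : ∀ {m} i (u : Word (suc m)) → shift (gcd i (suc m)) u ≡ u → shift i u ≡ u
shift-gcd⇐ {m} i u fixed with gcd[m,n]∣m i (suc m)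
... | divides q eq = trans (cong (λ z → shift z u) eq) (shift-*-period _ q u fixed)

runFree : ℕ → ℕ → ℕ
runFree n zero = 0
runFree n (suc d) = ∑ (words (suc d)) (λ v → ⟦ ¬? (hasCyclicRun? n v) ⟧)

module PeriodicWords {m : ℕ} (n d′ : ℕ) (d∣l : suc d′ ∣ suc m) where

  private
    l = suc m
    d = suc d′
    k = _∣_.quotient d∣l

    l≡k*d : l ≡ k * d
    l≡k*d = _∣_.equality d∣l

  PeriodicWithRun : Word l → Set
  PeriodicWithRun u = HasCyclicRun n u × shift d u ≡ u

  periodicWithRun? : ∀ (u : Word l) → Dec (PeriodicWithRun u)
  periodicWithRun? u = hasCyclicRun? n u ×-dec (shift d u ≟ᵛ u)

  prefix : Word l → Vec Bool d
  prefix u = tabulateℕ d (cyclic u)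

  repeat : Vec Bool d → Word l
  repeat v = tabulateℕ l (cyclic v)

  cyclic-period : ∀ (u : Word l) → shift d u ≡ u → ∀ t → cyclic u (t % d) ≡ cyclic u t
  cyclic-period u period t = begin
    cyclic u (t % d)                           ≡⟨ cong (λ w → cyclic w (t % d)) (shift-*-period d (t / d) u period) ⟨
    cyclic (shift (t / d * d) u) (t % d)       ≡⟨ cyclic-shift u (t / d * d) (t % d) ⟩
    cyclic u (t / d * d + t % d)               ≡⟨ cong (cyclic u) (trans (+-comm (t / d * d) (t % d)) (sym (m≡m%n+[m/n]*n t d))) ⟩
    cyclic u t                                 ∎
    where open ≡-Reasoning

  cyclic-prefix : ∀ (u : Word l) t → cyclic (prefix u) t ≡ cyclic u (t % d)
  cyclic-prefix u t = cyclic-tabulateℕ d′ (cyclic u) t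

  cyclic-repeat : ∀ (v : Vec Bool d) t → cyclic (repeat v) t ≡ cyclic v t
  cyclic-repeat v t = begin
    cyclic (repeat v) t                 ≡⟨ cyclic-tabulateℕ m (cyclic v) t ⟩
    cyclic v (t % l)                    ≡⟨ cyclic-periodic v (t / l * k) (t % l) ⟨
    cyclic v (t % l + t / l * k * d)    ≡⟨ cong (λ z → cyclic v (t % l + z)) (*-assoc (t / l) k d) ⟩
    cyclic v (t % l + t / l * (k * d))  ≡⟨ cong (λ z → cyclic v (t % l + t / l * z)) l≡k*d ⟨
    cyclic v (t % l + t / l * l)        ≡⟨ cong (cyclic v) (m≡m%n+[m/n]*n t l) ⟨
    cyclic v t                          ∎
    where open ≡-Reasoning

  repeat-prefix : ∀ (u : Word l) → PeriodicWithRun u → repeat (prefix u) ≡ u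
  repeat-prefix u (_ , period) = cyclic-ext _ u (λ t _ →
    trans (cyclic-repeat (prefix u) t) (trans (cyclic-prefix u t) (cyclic-period u period t)))

  prefix-repeat : ∀ (v : Vec Bool d) → HasCyclicRun n v → prefix (repeat v) ≡ v
  prefix-repeat v _ = cyclic-ext _ v (λ t _ →
    trans (cyclic-prefix (repeat v) t) (trans (cyclic-repeat v (t % d)) (cyclic-% v t)))

  prefix-hasCyclicRun : ∀ (u : Word l) → PeriodicWithRun u → HasCyclicRun n (prefix u)
  prefix-hasCyclicRun u ((j , _ , w) , period) = window⇒hasCyclicRun n (prefix u) j (λ {k} k<n →
    trans (cyclic-prefix u (j + k)) (trans (cyclic-period u period (j + k)) (w k<n)))

  repeat-periodicWithRun : ∀ (v : Vec Bool d) → HasCyclicRun n v → PeriodicWithRun (repeat v)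
  repeat-periodicWithRun v (j , _ , w) =
    window⇒hasCyclicRun n (repeat v) j (λ {k} k<n → trans (cyclic-repeat v (j + k)) (w k<n)) ,
    cyclic-ext _ _ (λ t _ → begin
      cyclic (shift d (repeat v)) t   ≡⟨ cyclic-shift (repeat v) d t ⟩
      cyclic (repeat v) (d + t)       ≡⟨ cyclic-repeat v (d + t) ⟩
      cyclic v (d + t)                ≡⟨ cyclic-+length v t ⟩
      cyclic v t                      ≡⟨ cyclic-repeat v t ⟨
      cyclic (repeat v) t             ∎)
    where open ≡-Reasoning

  count-periodicWithRun : ∑ (words l) (λ u → ⟦ periodicWithRun? u ⟧) ≡ ∑ (words d) (λ v → ⟦ hasCyclicRun? n v ⟧)
  count-periodicWithRun = Bijection.count-bijection _≟ᵛ_ _≟ᵛ_ (words l) (words d) (words-enumerates l) (words-enumerates d)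
    periodicWithRun? (hasCyclicRun? n) prefix repeat prefix-hasCyclicRun repeat-periodicWithRun repeat-prefix prefix-repeat

fixedWithRun+runFree : ∀ {m n} (n≤l : n ≤ suc m) i → fixedWithRun n≤l i + runFree n (gcd i (suc m)) ≡ 2 ^ gcd i (suc m)
fixedWithRun+runFree {m} {n} n≤l i = go (gcd i l) refl
  where
  l = suc m
  go : ∀ d → d ≡ gcd i l → fixedWithRun n≤l i + runFree n d ≡ 2 ^ d
  go zero d≡g = ⊥-elim (gcd[m,n]≢0 i l (inj₂ (λ ())) (sym d≡g))
  go (suc d′) d≡g = begin
    fixedWithRun n≤l i + runFree n d                    ≡⟨ cong (_+ runFree n d) (∑-cong (words l) fixedWithRun⇔periodic) ⟩
    ∑ (words l) (λ u → ⟦ periodicWithRun? u ⟧) + runFree n d   ≡⟨ cong (_+ runFree n d) count-periodicWithRun ⟩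
    ∑ (words d) (λ v → ⟦ hasCyclicRun? n v ⟧) + runFree n d ≡⟨ ∑-⟦⟧+∑-⟦¬⟧ (hasCyclicRun? n) (words d) ⟩
    length (words d)                                   ≡⟨ length-words d ⟩
    2 ^ d                                              ∎
    where
    open ≡-Reasoning
    d = suc d′
    open PeriodicWords n d′ (subst (_∣ l) (sym d≡g) (gcd[m,n]∣n i l))
    fixedWithRun⇔periodic : ∀ u → ⟦ hasRun? n u n≤l ⟧ * ⟦ shift i u ≟ᵛ u ⟧ ≡ ⟦ periodicWithRun? u ⟧
    fixedWithRun⇔periodic u with hasRun? n u n≤l | shift i u ≟ᵛ u
    ... | yes run | yes fixed = sym (⟦⟧-yes (periodicWithRun? u)
      (hasRun⇒hasCyclicRun n u n≤l run , subst (λ z → shift z u ≡ u) (sym d≡g) (shift-gcd⇒ i u fixed)))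
    ... | yes _ | no ¬fixed = sym (⟦⟧-no (periodicWithRun? u) (λ p → ¬fixed (shift-gcd⇐ i u (subst (λ z → shift z u ≡ u) d≡g (proj₂ p)))))
    ... | no ¬run | _ = sym (⟦⟧-no (periodicWithRun? u) (λ p → ¬run (hasCyclicRun⇒hasRun n u (proj₁ p))))

φ≡∑ : ∀ k → φ k ≡ ∑< k (λ i → ⟦ gcd (suc i) k ≟ 1 ⟧)
φ≡∑ k = length-filter (λ i → gcd (suc i) k ≟ 1) (upTo k)

gcd-multiple : ∀ c d k → gcd (c * d) (k * d) ≡ gcd c k * d
gcd-multiple c d k = begin
  gcd (c * d) (k * d) ≡⟨ cong₂ gcd (*-comm c d) (*-comm k d) ⟩
  gcd (d * c) (d * k) ≡⟨ c*gcd[m,n]≡gcd[cm,cn] d c k ⟨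
  d * gcd c k         ≡⟨ *-comm d (gcd c k) ⟩
  gcd c k * d         ∎
  where open ≡-Reasoning

-- Writing i + 1 = q d + r + 1 with r < d, gcd (i + 1) (k d) = d forces r = d - 1 and gcd (q + 1) k = 1.
count-gcd≡ : ∀ m j → ∑< (suc m) (λ i → ⟦ gcd i (suc m) ≟ suc j ⟧) ≡ ⟦ suc j ∣? suc m ⟧ * φ (suc m / suc j)
count-gcd≡ m j with suc j ∣? suc m
... | no d∤l = ∑<-zero (suc m) (λ i _ → ⟦⟧-no (gcd i (suc m) ≟ suc j) (λ g≡d → d∤l (subst (_∣ suc m) g≡d (gcd[m,n]∣n i (suc m)))))
... | yes (divides k l≡k*d) = begin
    ∑< l G                                   ≡⟨ +-cancelʳ-≡ (G 0) _ _ shift-by-one ⟨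
    ∑< l (G ∘ suc)                           ≡⟨ cong (λ z → ∑< z (G ∘ suc)) l≡k*d ⟩
    ∑< (k * d) (G ∘ suc)                     ≡⟨ ∑<-blocks k d (G ∘ suc) ⟩
    ∑< k (λ q → ∑< d (λ r → G (suc (q * d + r)))) ≡⟨ ∑<-cong k (λ q _ → block q) ⟩
    ∑< k (λ q → ⟦ gcd (suc q) k ≟ 1 ⟧)       ≡⟨ φ≡∑ k ⟨
    φ k                                      ≡⟨ cong φ (trans (cong (_/ d) l≡k*d) (m*n/n≡m k d)) ⟨
    φ (l / d)                                ≡⟨ +-identityʳ _ ⟨
    1 * φ (l / d)                            ∎
  where
  open ≡-Reasoning
  l = suc m
  d = suc j
  G : ℕ → ℕ
  G i = ⟦ gcd i l ≟ d ⟧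

  shift-by-one : ∑< l (G ∘ suc) + G 0 ≡ ∑< l G + G 0
  shift-by-one = begin
    ∑< l (G ∘ suc) + G 0  ≡⟨ +-comm _ (G 0) ⟩
    G 0 + ∑< l (G ∘ suc)  ≡⟨ ∑<-suc l G ⟨
    ∑< (suc l) G          ≡⟨ ∑<-snoc l G ⟩
    ∑< l G + G l          ≡⟨ cong (λ z → ∑< l G + ⟦ z ≟ d ⟧) (trans gcd[l,l]≡l (sym (gcd-identityˡ l))) ⟩
    ∑< l G + G 0          ∎
    where
    gcd[l,l]≡l : gcd l l ≡ l
    gcd[l,l]≡l = GCD.unique (gcd-GCD l l) GCD.refl

  gcd-block : ∀ c → gcd (c * d) l ≡ gcd c k * d
  gcd-block c = trans (cong (gcd (c * d)) l≡k*d) (gcd-multiple c d k)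

  block : ∀ q → ∑< d (λ r → G (suc (q * d + r))) ≡ ⟦ gcd (suc q) k ≟ 1 ⟧
  block q = trans (∑<-pick d j _ ≤-refl off-end) (⟦⟧-cong (gcd (suc (q * d + j)) l ≟ d) (gcd (suc q) k ≟ 1) to from)
    where
    end : suc (q * d + j) ≡ suc q * d
    end = trans (sym (+-suc (q * d) j)) (+-comm (q * d) d)
    to : gcd (suc (q * d + j)) l ≡ d → gcd (suc q) k ≡ 1
    to g≡d = *-cancelʳ-≡ (gcd (suc q) k) 1 d
      (trans (sym (gcd-block (suc q))) (trans (cong (λ z → gcd z l) (sym end)) (trans g≡d (sym (*-identityˡ d)))))
    from : gcd (suc q) k ≡ 1 → gcd (suc (q * d + j)) l ≡ d
    from g≡1 = trans (cong (λ z → gcd z l) end) (trans (gcd-block (suc q)) (trans (cong (_* d) g≡1) (*-identityˡ d)))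
    off-end : ∀ r → r < d → r ≢ j → G (suc (q * d + r)) ≡ 0
    off-end r r<d r≢j = ⟦⟧-no (gcd (suc (q * d + r)) l ≟ d) λ g≡d →
      let d∣qd+r+1 = subst (_∣ suc (q * d + r)) g≡d (gcd[m,n]∣m _ l)
          d∣r+1 = ∣m+n∣m⇒∣n (subst (d ∣_) (sym (+-suc (q * d) r)) d∣qd+r+1) (n∣m*n q)
      in <⇒≱ (s≤s (≤∧≢⇒< (≤-pred r<d) r≢j)) (∣⇒≤ d∣r+1)

∑<-by-gcd : ∀ m (F : ℕ → ℕ) →
  ∑< (suc m) (λ i → F (gcd i (suc m))) ≡ ∑< (suc m) (λ j → ⟦ suc j ∣? suc m ⟧ * (φ (suc m / suc j) * F (suc j)))
∑<-by-gcd m F = begin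
  ∑< l (λ i → F (gcd i l))                                   ≡⟨ ∑<-cong l (λ i _ → ∑-at-gcd i) ⟨
  ∑< l (λ i → ∑< l (λ j → ⟦ gcd i l ≟ suc j ⟧ * F (suc j)))  ≡⟨ ∑-swap (upTo l) (upTo l) _ ⟩
  ∑< l (λ j → ∑< l (λ i → ⟦ gcd i l ≟ suc j ⟧ * F (suc j)))  ≡⟨ ∑<-cong l (λ j _ → ∑-*ʳ (upTo l) (F (suc j)) (λ i → ⟦ gcd i l ≟ suc j ⟧)) ⟩
  ∑< l (λ j → ∑< l (λ i → ⟦ gcd i l ≟ suc j ⟧) * F (suc j))  ≡⟨ ∑<-cong l (λ j _ → cong (_* F (suc j)) (count-gcd≡ m j)) ⟩
  ∑< l (λ j → ⟦ suc j ∣? l ⟧ * φ (l / suc j) * F (suc j))    ≡⟨ ∑<-cong l (λ j _ → *-assoc ⟦ suc j ∣? l ⟧ _ _) ⟩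
  ∑< l (λ j → ⟦ suc j ∣? l ⟧ * (φ (l / suc j) * F (suc j)))  ∎
  where
  open ≡-Reasoning
  l = suc m
  ∑-at-gcd : ∀ i → ∑< l (λ j → ⟦ gcd i l ≟ suc j ⟧ * F (suc j)) ≡ F (gcd i l)
  ∑-at-gcd i = go (gcd i l) refl
    where
    go : ∀ g → g ≡ gcd i l → ∑< l (λ j → ⟦ g ≟ suc j ⟧ * F (suc j)) ≡ F g
    go zero g≡ = ⊥-elim (gcd[m,n]≢0 i l (inj₂ (λ ())) (sym g≡))
    go (suc r) g≡ = begin
      ∑< l (λ j → ⟦ suc r ≟ suc j ⟧ * F (suc j))
        ≡⟨ ∑<-pick l r _ r<l (λ j _ j≢r → cong (_* F (suc j)) (⟦⟧-no (suc r ≟ suc j) (j≢r ∘ sym ∘ suc-injective))) ⟩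
      ⟦ suc r ≟ suc r ⟧ * F (suc r)              ≡⟨ cong (_* F (suc r)) (⟦⟧-yes (suc r ≟ suc r) refl) ⟩
      1 * F (suc r)                              ≡⟨ *-identityˡ _ ⟩
      F (suc r)                                  ∎
      where
      r<l : r < l
      r<l = subst (_≤ l) (sym g≡) (∣⇒≤ (gcd[m,n]∣n i l))

-- Words without cyclic runs as closed walks of an automaton

TrailingRun : (ℕ → Bool) → ℕ → ℕ → Set
TrailingRun f t r = ∃[ b ] (t ≡ suc (b + r) × f b ≡ false × (∀ i → i < r → f (suc (b + i)) ≡ true))

trailingRun-false : ∀ f t → f t ≡ false → TrailingRun f (suc t) 0
trailingRun-false f t ft = t , cong suc (sym (+-identityʳ t)) , ft , (λ _ ())

trailingRun-true : ∀ f t r → TrailingRun f t r → f t ≡ true → TrailingRun f (suc t) (suc r)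
trailingRun-true f t r (b , t≡ , fb , trues) ft = b , cong suc (trans t≡ (sym (+-suc b r))) , fb , trues′
  where
  trues′ : ∀ i → i < suc r → f (suc (b + i)) ≡ true
  trues′ i (s≤s i≤r) with m≤n⇒m<n∨m≡n i≤r
  ... | inj₁ i<r = trues i i<r
  ... | inj₂ refl = trans (cong f (sym t≡)) ft

true≢false : true ≢ false
true≢false ()

private
  run-overlap : ∀ f b r b′ r′ → b + r ≡ b′ + r′ → r < r′ → f b ≡ false → ¬ (∀ i → i < r′ → f (suc (b′ + i)) ≡ true)
  run-overlap f b r b′ r′ eq r<r′ fb trues′ with m≤n⇒∃[o]m+o≡n r<r′
  ... | o , refl = true≢false (trans (sym (trues′ o (s≤s (m≤n+m o r)))) (trans (cong f (sym b≡)) fb))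
    where
    rearrange : ∀ b′ r o → b′ + (suc r + o) ≡ suc (b′ + o) + r
    rearrange = solve-∀
    b≡ : b ≡ suc (b′ + o)
    b≡ = +-cancelʳ-≡ r b (suc (b′ + o)) (trans eq (rearrange b′ r o))

trailingRun-unique : ∀ f t r r′ → TrailingRun f t r → TrailingRun f t r′ → r ≡ r′
trailingRun-unique f t r r′ (b , t≡ , fb , trues) (b′ , t≡′ , fb′ , trues′) with <-cmp r r′
... | tri≈ _ r≡r′ _ = r≡r′
... | tri< r<r′ _ _ = ⊥-elim (run-overlap f b r b′ r′ (suc-injective (trans (sym t≡) t≡′)) r<r′ fb trues′)
... | tri> _ _ r′<r = ⊥-elim (run-overlap f b′ r′ b r (suc-injective (trans (sym t≡′) t≡)) r′<r fb′ trues)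

trailingRun-exists : ∀ f b t → f b ≡ false → b < t → ∃[ r ] TrailingRun f t r
trailingRun-exists f b (suc t) fb (s≤s b≤t) with f t in ft
... | false = 0 , trailingRun-false f t ft
... | true with m≤n⇒m<n∨m≡n b≤t
...   | inj₁ b<t = let (r , trail) = trailingRun-exists f b t fb b<t in suc r , trailingRun-true f t r trail ft
...   | inj₂ refl = ⊥-elim (true≢false (trans (sym ft) fb))

trailingRun-periodic : ∀ f p t r → (∀ t → f (p + t) ≡ f t) → TrailingRun f t r → TrailingRun f (p + t) r
trailingRun-periodic f p t r periodic (b , t≡ , fb , trues) =
  p + b , trans (cong (p +_) t≡) (rearrange p b r) , trans (periodic b) fb ,
  λ i i<r → trans (cong f (sym (rearrange p b i))) (trans (periodic (suc (b + i))) (trues i i<r))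
  where
  rearrange : ∀ p b r → p + suc (b + r) ≡ suc (p + b + r)
  rearrange = solve-∀

window⇒trailingRun-≥ : ∀ n f a r → Window n f a → TrailingRun f (a + n) r → n ≤ r
window⇒trailingRun-≥ n f a r window (b , a+n≡ , fb , _) with n ≤? r
... | yes n≤r = n≤r
... | no n≰r with m≤n⇒∃[o]m+o≡n (≰⇒> n≰r)
...   | o , refl = ⊥-elim (true≢false (trans (sym (window (m<n+m o (s≤s z≤n)))) (trans (cong f a+o≡b) fb)))
  where
  rearrange : ∀ a r o → a + (suc r + o) ≡ suc (a + o + r)
  rearrange = solve-∀
  a+o≡b : a + o ≡ b
  a+o≡b = +-cancelʳ-≡ r _ _ (suc-injective (trans (sym (rearrange a r o)) a+n≡))

trailingRun⇒window : ∀ n f t r → TrailingRun f t r → n ≤ r → ∃[ a ] (a + n ≡ t × Window n f a)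
trailingRun⇒window n f t r (b , t≡ , _ , trues) n≤r with m≤n⇒∃[o]m+o≡n n≤r
... | o , refl = suc (b + o) , trans (rearrange b o n) (sym t≡) ,
      λ {k} k<n → trans (cong f (rearrange′ b o k)) (trues (o + k) (subst (o + k <_) (+-comm o n) (+-monoʳ-< o k<n)))
  where
  rearrange : ∀ b o n → suc (b + o) + n ≡ suc (b + (n + o))
  rearrange = solve-∀
  rearrange′ : ∀ b o k → suc (b + o) + k ≡ suc (b + (o + k))
  rearrange′ = solve-∀

Reads : ∀ {k} → Vec Bool k → (ℕ → Bool) → ℕ → Set
Reads {k} x f t₀ = ∀ i → i < k → lookupℕ x i ≡ f (t₀ + i)

reads-tail : ∀ {k y} {x : Vec Bool k} f t₀ → Reads (y ∷ x) f t₀ → Reads x f (suc t₀)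
reads-tail f t₀ reads i i<k = trans (reads (suc i) (s≤s i<k)) (cong f (+-suc t₀ i))

module _ {k : ℕ} {f : ℕ → Bool} {t₀ : ℕ} where

  reads-head : ∀ {y} {x : Vec Bool k} → Reads (y ∷ x) f t₀ → f t₀ ≡ y
  reads-head reads = sym (trans (reads 0 (s≤s z≤n)) (cong f (+-identityʳ t₀)))

  reads-false : ∀ {x : Vec Bool k} → Reads (false ∷ x) f t₀ → TrailingRun f (suc t₀) 0
  reads-false reads = trailingRun-false f t₀ (reads-head reads)

  reads-true : ∀ {x : Vec Bool k} {r} → Reads (true ∷ x) f t₀ → TrailingRun f t₀ r → TrailingRun f (suc t₀) (suc r)
  reads-true reads trail = trailingRun-true f t₀ _ trail (reads-head reads)

  trailingRun-+-suc : ∀ {e} → TrailingRun f (suc t₀ + k) e → TrailingRun f (t₀ + suc k) e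
  trailingRun-+-suc {e} = subst (λ t → TrailingRun f t e) (sym (+-suc t₀ k))

-- The state of the automaton is the length of the current run of trues; it fails as soon as that
-- length would reach n = suc n′.
module RunAutomaton (n′ : ℕ) where

  n : ℕ
  n = suc n′

  read : ∀ {k} → ℕ → Vec Bool k → Maybe ℕ
  read r [] = just r
  read r (false ∷ v) = read 0 v
  read r (true ∷ v) with suc r <? n
  ... | yes _ = read (suc r) v
  ... | no _ = nothing

  read-all-true : ∀ {k} (x : Vec Bool k) s e → (∀ i → i < k → lookupℕ x i ≡ true) → read s x ≡ just e → e ≡ s + k
  read-all-true [] s e _ refl = sym (+-identityʳ s)
  read-all-true (false ∷ x) s e trues _ = ⊥-elim (true≢false (sym (trues 0 (s≤s z≤n))))
  read-all-true (true ∷ x) s e trues ok with suc s <? n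
  ... | yes _ = trans (read-all-true x (suc s) e (λ i i<k → trues (suc i) (s≤s i<k)) ok) (sym (+-suc s _))
  read-all-true (true ∷ x) s e trues () | no _

  read-step : ∀ {k y} {x : Vec Bool k} f t₀ r e → Reads (y ∷ x) f t₀ → TrailingRun f t₀ r → read r (y ∷ x) ≡ just e →
    ∃[ r′ ] (r′ < n × TrailingRun f (suc t₀) r′ × read r′ x ≡ just e)
  read-step {y = false} f t₀ r e reads _ ok = 0 , s≤s z≤n , reads-false reads , ok
  read-step {y = true} f t₀ r e reads trail ok with suc r <? n
  ... | yes r+1<n = suc r , r+1<n , reads-true reads trail , ok
  read-step {y = true} f t₀ r e reads trail () | no _

  read-tracks : ∀ {k} (x : Vec Bool k) f t₀ r e → Reads x f t₀ → TrailingRun f t₀ r → read r x ≡ just e →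
    TrailingRun f (t₀ + k) e
  read-tracks [] f t₀ r e _ trail refl = subst (λ t → TrailingRun f t r) (sym (+-identityʳ t₀)) trail
  read-tracks (y ∷ x) f t₀ r e reads trail ok with read-step f t₀ r e reads trail ok
  ... | r′ , _ , trail′ , ok′ = trailingRun-+-suc (read-tracks x f (suc t₀) r′ e (reads-tail f t₀ reads) trail′ ok′)

  read-tracks-false : ∀ {k} (x : Vec Bool k) f t₀ s e → Reads x f t₀ → (∃[ p ] (p < k × lookupℕ x p ≡ false)) →
    read s x ≡ just e → TrailingRun f (t₀ + k) e
  read-tracks-false (false ∷ x) f t₀ s e reads _ ok =
    trailingRun-+-suc (read-tracks x f (suc t₀) 0 e (reads-tail f t₀ reads) (reads-false reads) ok)
  read-tracks-false (true ∷ x) f t₀ s e reads (zero , _ , ()) ok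
  read-tracks-false (true ∷ x) f t₀ s e reads (suc p , s≤s p<k , xp) ok with suc s <? n
  ... | yes _ = trailingRun-+-suc (read-tracks-false x f (suc t₀) (suc s) e (reads-tail f t₀ reads) (p , p<k , xp) ok)
  read-tracks-false (true ∷ x) f t₀ s e reads (suc p , s≤s p<k , xp) () | no _

  NoWindowEnding : (ℕ → Bool) → ℕ → ℕ → Set
  NoWindowEnding f t₀ k = ∀ a → t₀ < a + n → a + n ≤ t₀ + k → ¬ Window n f a

  noWindowEnding-tail : ∀ f t₀ k → NoWindowEnding f t₀ (suc k) → NoWindowEnding f (suc t₀) k
  noWindowEnding-tail f t₀ k none a t₀<a+n a+n≤ = none a (≤-trans (n≤1+n _) t₀<a+n) (subst (a + n ≤_) (sym (+-suc t₀ k)) a+n≤)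

  read-just⇒noWindowEnding : ∀ {k} (x : Vec Bool k) f t₀ r e → Reads x f t₀ → TrailingRun f t₀ r → read r x ≡ just e →
    NoWindowEnding f t₀ k
  read-just⇒noWindowEnding [] f t₀ r e _ _ _ a t₀<a+n a+n≤ _ = <⇒≱ t₀<a+n (subst (a + n ≤_) (+-identityʳ t₀) a+n≤)
  read-just⇒noWindowEnding {suc k} (y ∷ x) f t₀ r e reads trail ok a t₀<a+n a+n≤ window
    with read-step f t₀ r e reads trail ok | m≤n⇒m<n∨m≡n t₀<a+n
  ... | r′ , _ , trail′ , ok′ | inj₁ t₀+1<a+n = read-just⇒noWindowEnding x f (suc t₀) r′ e (reads-tail f t₀ reads) trail′ ok′
    a t₀+1<a+n (subst (a + n ≤_) (+-suc t₀ k) a+n≤) window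
  ... | r′ , r′<n , trail′ , _ | inj₂ t₀+1≡a+n =
    <⇒≱ r′<n (window⇒trailingRun-≥ n f a r′ window (subst (λ t → TrailingRun f t r′) t₀+1≡a+n trail′))

  noWindowEnding⇒read-just : ∀ {k} (x : Vec Bool k) f t₀ r → Reads x f t₀ → TrailingRun f t₀ r → r < n →
    NoWindowEnding f t₀ k → ∃[ e ] (read r x ≡ just e)
  noWindowEnding⇒read-just [] f t₀ r _ _ _ _ = r , refl
  noWindowEnding⇒read-just {suc k} (false ∷ x) f t₀ r reads trail r<n none =
    noWindowEnding⇒read-just x f (suc t₀) 0 (reads-tail f t₀ reads) (reads-false reads) (s≤s z≤n) (noWindowEnding-tail f t₀ k none)
  noWindowEnding⇒read-just {suc k} (true ∷ x) f t₀ r reads trail r<n none with suc r <? n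
  ... | yes r+1<n = noWindowEnding⇒read-just x f (suc t₀) (suc r) (reads-tail f t₀ reads) (reads-true reads trail) r+1<n
    (noWindowEnding-tail f t₀ k none)
  ... | no r+1≮n with trailingRun⇒window n f (suc t₀) (suc r) (reads-true reads trail) (≮⇒≥ r+1≮n)
  ...   | a , a+n≡ , window = ⊥-elim (none a (subst (t₀ <_) (sym a+n≡) ≤-refl)
    (subst (_≤ t₀ + suc k) (sym a+n≡) (subst (suc t₀ ≤_) (sym (+-suc t₀ k)) (s≤s (m≤m+n t₀ k)))) window)

  window-in-period : ∀ {d′} (v : Vec Bool (suc d′)) j → Window n (cyclic v) j →
    ∃[ a ] (n * suc d′ < a + n × a + n ≤ n * suc d′ + suc d′ × Window n (cyclic v) a)
  window-in-period {d′} v j window =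
    a , subst (t₀ <_) (sym a+n≡) (m<m+n t₀ (s≤s z≤n)) , subst (_≤ t₀ + d) (sym a+n≡) (+-monoʳ-≤ t₀ (m%n<n (j + n′) d)) ,
    λ {k} k<n → begin
      cyclic v (a + k)                      ≡⟨ cyclic-periodic v q (a + k) ⟨
      cyclic v (a + k + q * d)              ≡⟨ cong (cyclic v) (trans (regroup n′ d′ ρ k (q * d))
                                                 (trans (cong (n′ * d′ + d + k +_) (sym j+n′≡)) (shift-back n′ d′ j k))) ⟩
      cyclic v (j + k + n * d)              ≡⟨ cyclic-periodic v n (j + k) ⟩
      cyclic v (j + k)                      ≡⟨ window k<n ⟩
      true                                  ∎
    where
    open ≡-Reasoning
    d = suc d′
    t₀ = n * d
    ρ = (j + n′) % d
    q = (j + n′) / d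
    a = n′ * d′ + d + ρ
    j+n′≡ : j + n′ ≡ ρ + q * d
    j+n′≡ = m≡m%n+[m/n]*n (j + n′) d
    end : ∀ n′ d′ ρ → n′ * d′ + suc d′ + ρ + suc n′ ≡ suc n′ * suc d′ + suc ρ
    end = solve-∀
    a+n≡ : a + n ≡ t₀ + suc ρ
    a+n≡ = end n′ d′ ρ
    regroup : ∀ n′ d′ ρ k x → n′ * d′ + suc d′ + ρ + k + x ≡ (n′ * d′ + suc d′ + k) + (ρ + x)
    regroup = solve-∀
    shift-back : ∀ n′ d′ j k → (n′ * d′ + suc d′ + k) + (j + n′) ≡ j + k + suc n′ * suc d′
    shift-back = solve-∀

  _≟ᵐ_ : DecidableEquality (Maybe ℕ)
  _≟ᵐ_ = Maybe.≡-dec _≟_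

  -- v is read at position n * d of the stream cyclic v, late enough that every window of n trues
  -- ending in the following period lies inside the stream. Then read s v ≡ just s exactly when s is
  -- the trailing run at that position and no such window exists.
  module ClosedReads {d′ : ℕ} (v : Vec Bool (suc d′)) where

    private
      d = suc d′
      f = cyclic v
      t₀ = n * d

      reads-v : Reads v f t₀
      reads-v i i<d = sym (trans (cong f (+-comm t₀ i)) (trans (cyclic-periodic v n i) (cyclic-< v i i<d)))

      closed : ℕ → ℕ
      closed s = ⟦ read s v ≟ᵐ just s ⟧

    all-true : (∀ i → i < d → lookupℕ v i ≡ true) → ∑< n closed ≡ ⟦ ¬? (hasCyclicRun? n v) ⟧
    all-true trues = trans
      (∑<-zero n (λ s _ → ⟦⟧-no (read s v ≟ᵐ just s) (λ ok → m+1+n≢m s (sym (read-all-true v s s trues ok)))))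
      (sym (⟦⟧-no (¬? (hasCyclicRun? n v)) (λ ¬run → ¬run (0 , s≤s z≤n , λ {k} _ → trues (k % d) (m%n<n k d)))))

    module _ (p : ℕ) (p<d : p < d) (vp : lookupℕ v p ≡ false) (r : ℕ) (trail : TrailingRun f t₀ r) where

      trail-end : TrailingRun f (t₀ + d) r
      trail-end = subst (λ t → TrailingRun f t r) (+-comm d t₀) (trailingRun-periodic f d t₀ r (cyclic-+length v) trail)

      closed⇒trailing : ∀ s → read s v ≡ just s → s ≡ r
      closed⇒trailing s ok = trailingRun-unique f (t₀ + d) s r (read-tracks-false v f t₀ s s reads-v (p , p<d , vp) ok) trail-end

      with-run : HasCyclicRun n v → ∑< n closed ≡ ⟦ ¬? (hasCyclicRun? n v) ⟧
      with-run run@(j , _ , window) = trans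
        (∑<-zero n (λ s _ → ⟦⟧-no (read s v ≟ᵐ just s) (not-closed s)))
        (sym (⟦⟧-no (¬? (hasCyclicRun? n v)) (λ ¬run → ¬run run)))
        where
        not-closed : ∀ s → read s v ≢ just s
        not-closed s ok with closed⇒trailing s ok | window-in-period v j window
        ... | refl | a , after , before , window′ = read-just⇒noWindowEnding v f t₀ s s reads-v trail ok a after before window′

      without-run : ¬ HasCyclicRun n v → ∑< n closed ≡ ⟦ ¬? (hasCyclicRun? n v) ⟧
      without-run ¬run = trans (∑<-pick n r closed r<n others)
        (trans (⟦⟧-yes (read r v ≟ᵐ just r) read-r) (sym (⟦⟧-yes (¬? (hasCyclicRun? n v)) ¬run)))
        where
        r<n : r < n
        r<n with r <? n
        ... | yes r<n = r<n
        ... | no r≮n with trailingRun⇒window n f t₀ r trail (≮⇒≥ r≮n)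
        ...   | a , _ , window = ⊥-elim (¬run (window⇒hasCyclicRun n v a window))
        succeeds : ∃[ e ] (read r v ≡ just e)
        succeeds = noWindowEnding⇒read-just v f t₀ r reads-v trail r<n (λ a _ _ window → ¬run (window⇒hasCyclicRun n v a window))
        read-r : read r v ≡ just r
        read-r = trans (proj₂ succeeds) (cong just (trailingRun-unique f (t₀ + d) _ r
          (read-tracks v f t₀ r (proj₁ succeeds) reads-v trail (proj₂ succeeds)) trail-end))
        others : ∀ s → s < n → s ≢ r → closed s ≡ 0
        others s _ s≢r = ⟦⟧-no (read s v ≟ᵐ just s) (s≢r ∘ closed⇒trailing s)

    ∑-closed : ∑< n closed ≡ ⟦ ¬? (hasCyclicRun? n v) ⟧
    ∑-closed with anyUpTo? (λ i → lookupℕ v i Bool.≟ false) d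
    ... | no no-false = all-true (λ i i<d → Bool.¬-not (λ vi≡false → no-false (i , i<d , vi≡false)))
    ... | yes (p , p<d , vp) with trailingRun-exists f p t₀ (trans (cyclic-< v p p<d) vp) (≤-trans p<d (m≤n*m d n))
    ...   | r , trail = by-run (hasCyclicRun? n v)
      where
      by-run : Dec (HasCyclicRun n v) → ∑< n closed ≡ ⟦ ¬? (hasCyclicRun? n v) ⟧
      by-run (yes run) = with-run p p<d vp r trail run
      by-run (no ¬run) = without-run p p<d vp r trail ¬run

  accepts : ℕ → ℕ → ℕ → ℕ
  accepts r s k = ∑ (words k) (λ v → ⟦ read r v ≟ᵐ just s ⟧)

  runFree≡trace : ∀ d′ → runFree n (suc d′) ≡ ∑< n (λ s → accepts s s (suc d′))
  runFree≡trace d′ = trans (∑-cong (words (suc d′)) (λ v → sym (ClosedReads.∑-closed v)))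
    (∑-swap (words (suc d′)) (upTo n) (λ v s → ⟦ read s v ≟ᵐ just s ⟧))

module PathCounts (n′ : ℕ) where

  open RunAutomaton n′

  paths : ℕ → ℕ → ℕ → ℕ
  paths r s zero = ⟦ r ≟ s ⟧
  paths r s (suc k) = ⟦ suc r <? n ⟧ * paths (suc r) s k + paths 0 s k

  accepts≡paths : ∀ k r s → accepts r s k ≡ paths r s k
  accepts≡paths zero r s = trans (+-identityʳ _) (⟦⟧-cong (just r ≟ᵐ just s) (r ≟ s) Maybe.just-injective (cong just))
  accepts≡paths (suc k) r s = begin
    ∑ (map (true ∷_) (words k) ++ map (false ∷_) (words k)) (λ v → ⟦ read r v ≟ᵐ just s ⟧)
      ≡⟨ ∑-++ (map (true ∷_) (words k)) _ _ ⟩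
    ∑ (map (true ∷_) (words k)) (λ v → ⟦ read r v ≟ᵐ just s ⟧) + ∑ (map (false ∷_) (words k)) (λ v → ⟦ read r v ≟ᵐ just s ⟧)
      ≡⟨ cong₂ _+_ (∑-map (true ∷_) (words k) _) (trans (∑-map (false ∷_) (words k) _) (accepts≡paths k 0 s)) ⟩
    ∑ (words k) (λ v → ⟦ read r (true ∷ v) ≟ᵐ just s ⟧) + paths 0 s k
      ≡⟨ cong (_+ paths 0 s k) after-true ⟩
    ⟦ suc r <? n ⟧ * paths (suc r) s k + paths 0 s k ∎
    where
    open ≡-Reasoning
    after-true : ∑ (words k) (λ v → ⟦ read r (true ∷ v) ≟ᵐ just s ⟧) ≡ ⟦ suc r <? n ⟧ * paths (suc r) s k
    after-true with suc r <? n
    ... | yes _ = trans (accepts≡paths k (suc r) s) (sym (+-identityʳ _))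
    ... | no _ = ∑-zero (words k) (λ _ _ → refl)

  paths-to-0 : ∀ k r → r < n → paths r 0 (suc k) ≡ ∑< n (λ s → paths r s k)
  paths-to-0 zero r r<n = begin
    ⟦ suc r <? n ⟧ * 0 + 1   ≡⟨ cong (_+ 1) (*-zeroʳ ⟦ suc r <? n ⟧) ⟩
    1                        ≡⟨ ⟦⟧-yes (r ≟ r) refl ⟨
    ⟦ r ≟ r ⟧                ≡⟨ ∑<-pick n r (λ s → ⟦ r ≟ s ⟧) r<n (λ s _ s≢r → ⟦⟧-no (r ≟ s) (s≢r ∘ sym)) ⟨
    ∑< n (λ s → ⟦ r ≟ s ⟧)   ∎
    where open ≡-Reasoning
  paths-to-0 (suc k) r r<n = begin
    ⟦ suc r <? n ⟧ * paths (suc r) 0 (suc k) + paths 0 0 (suc k)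
      ≡⟨ cong₂ _+_ (⟦⟧*-cong (suc r <? n) (paths-to-0 k (suc r))) (paths-to-0 k 0 (s≤s z≤n)) ⟩
    ⟦ suc r <? n ⟧ * ∑< n (λ s → paths (suc r) s k) + ∑< n (λ s → paths 0 s k)
      ≡⟨ cong (_+ ∑< n (λ s → paths 0 s k)) (∑-*ˡ (upTo n) ⟦ suc r <? n ⟧ _) ⟨
    ∑< n (λ s → ⟦ suc r <? n ⟧ * paths (suc r) s k) + ∑< n (λ s → paths 0 s k)
      ≡⟨ ∑-+ (upTo n) (λ s → ⟦ suc r <? n ⟧ * paths (suc r) s k) (λ s → paths 0 s k) ⟨
    ∑< n (λ s → paths r s (suc k)) ∎
    where open ≡-Reasoning

  paths-to-suc : ∀ s → suc s < n → ∀ k r → paths r (suc s) (suc k) ≡ paths r s k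
  paths-to-suc s s+1<n zero r = after-true (suc r <? n)
    where
    after-true : (r+1<n? : Dec (suc r < n)) → ⟦ r+1<n? ⟧ * ⟦ suc r ≟ suc s ⟧ + 0 ≡ ⟦ r ≟ s ⟧
    after-true (yes _) = trans (+-identityʳ _) (trans (+-identityʳ _) (⟦⟧-cong (suc r ≟ suc s) (r ≟ s) suc-injective (cong suc)))
    after-true (no r+1≮n) = sym (⟦⟧-no (r ≟ s) (λ { refl → r+1≮n s+1<n }))
  paths-to-suc s s+1<n (suc k) r =
    cong₂ _+_ (cong (⟦ suc r <? n ⟧ *_) (paths-to-suc s s+1<n k (suc r))) (paths-to-suc s s+1<n k 0)

  compositions : ℕ → ℕ
  compositions k = paths 0 0 k

  paths-from-0 : ∀ s → s < n → ∀ k → paths 0 s k ≡ ⟦ s ≤? k ⟧ * compositions (k ∸ s)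
  paths-from-0 zero _ k = sym (trans (cong (_* compositions k) (⟦⟧-yes (0 ≤? k) z≤n)) (+-identityʳ _))
  paths-from-0 (suc s) _ zero = sym (cong (_* compositions 0) (⟦⟧-no (suc s ≤? 0) (λ ())))
  paths-from-0 (suc s) s+1<n (suc k) = begin
    paths 0 (suc s) (suc k)             ≡⟨ paths-to-suc s s+1<n k 0 ⟩
    paths 0 s k                         ≡⟨ paths-from-0 s (<-trans (n<1+n s) s+1<n) k ⟩
    ⟦ s ≤? k ⟧ * compositions (k ∸ s)   ≡⟨ cong (_* compositions (k ∸ s)) (⟦⟧-cong (s ≤? k) (suc s ≤? suc k) s≤s ≤-pred) ⟩
    ⟦ suc s ≤? suc k ⟧ * compositions (k ∸ s) ∎
    where open ≡-Reasoning

  compositions-suc : ∀ k → compositions (suc k) ≡ ∑< n (λ s → ⟦ s ≤? k ⟧ * compositions (k ∸ s))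
  compositions-suc k = trans (paths-to-0 k 0 (s≤s z≤n)) (∑<-cong n (λ s s<n → paths-from-0 s s<n k))

  paths-by-first-false : ∀ k r s → r < n →
    paths r s k ≡ ∑< k (λ j → ⟦ r + j <? n ⟧ * paths 0 s (k ∸ suc j)) + ⟦ r + k ≟ s ⟧ * ⟦ r + k <? n ⟧
  paths-by-first-false zero r s r<n = sym (begin
    ⟦ r + 0 ≟ s ⟧ * ⟦ r + 0 <? n ⟧   ≡⟨ cong (λ z → ⟦ z ≟ s ⟧ * ⟦ z <? n ⟧) (+-identityʳ r) ⟩
    ⟦ r ≟ s ⟧ * ⟦ r <? n ⟧           ≡⟨ cong (⟦ r ≟ s ⟧ *_) (⟦⟧-yes (r <? n) r<n) ⟩
    ⟦ r ≟ s ⟧ * 1                    ≡⟨ *-identityʳ _ ⟩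
    ⟦ r ≟ s ⟧                        ∎)
    where open ≡-Reasoning
  paths-by-first-false (suc k) r s r<n = by-first-letter (suc r <? n)
    where
    open ≡-Reasoning
    later : ℕ → ℕ
    later j = ⟦ r + suc j <? n ⟧ * paths 0 s (k ∸ suc j)
    last : ℕ
    last = ⟦ r + suc k ≟ s ⟧ * ⟦ r + suc k <? n ⟧
    r+0<n : ⟦ r + 0 <? n ⟧ ≡ 1
    r+0<n = ⟦⟧-yes (r + 0 <? n) (subst (_< n) (sym (+-identityʳ r)) r<n)
    split-first : ∑< (suc k) (λ j → ⟦ r + j <? n ⟧ * paths 0 s (suc k ∸ suc j)) + last ≡ 1 * paths 0 s k + ∑< k later + last
    split-first = cong (_+ last) (trans (∑<-suc k _) (cong (λ z → z * paths 0 s k + ∑< k later) r+0<n))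
    by-first-letter : (r+1<n? : Dec (suc r < n)) → ⟦ r+1<n? ⟧ * paths (suc r) s k + paths 0 s k ≡
      ∑< (suc k) (λ j → ⟦ r + j <? n ⟧ * paths 0 s (suc k ∸ suc j)) + last
    by-first-letter (yes r+1<n) = sym (begin
      _                                      ≡⟨ split-first ⟩
      1 * paths 0 s k + ∑< k later + last    ≡⟨ rotate (paths 0 s k) (∑< k later) last ⟩
      1 * (∑< k later + last) + paths 0 s k  ≡⟨ cong (λ z → 1 * z + paths 0 s k) (sym (trans (paths-by-first-false k (suc r) s r+1<n)
                                                  (cong₂ _+_ (∑<-cong k (λ j _ → cong (λ z → ⟦ z <? n ⟧ * paths 0 s (k ∸ suc j)) (sym (+-suc r j))))
                                                             (cong (λ z → ⟦ z ≟ s ⟧ * ⟦ z <? n ⟧) (sym (+-suc r k)))))) ⟩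
      1 * paths (suc r) s k + paths 0 s k    ∎)
      where
      rotate : ∀ x y z → 1 * x + y + z ≡ 1 * (y + z) + x
      rotate = solve-∀
    by-first-letter (no r+1≮n) = sym (begin
      _                                      ≡⟨ split-first ⟩
      1 * paths 0 s k + ∑< k later + last    ≡⟨ cong₂ (λ y z → 1 * paths 0 s k + y + z)
                                                  (∑<-zero k (λ j _ → cong (_* paths 0 s (k ∸ suc j)) (⟦⟧-no (r + suc j <? n) (too-long j))))
                                                  (trans (cong (⟦ r + suc k ≟ s ⟧ *_) (⟦⟧-no (r + suc k <? n) (too-long k))) (*-zeroʳ ⟦ r + suc k ≟ s ⟧)) ⟩
      1 * paths 0 s k + 0 + 0                ≡⟨ trans (+-identityʳ _) (trans (+-identityʳ _) (*-identityˡ _)) ⟩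
      paths 0 s k                            ∎)
      where
      too-long : ∀ j → ¬ (r + suc j < n)
      too-long j r+j+1<n = r+1≮n (≤-<-trans (subst (suc r ≤_) (sym (+-suc r j)) (s≤s (m≤m+n r j))) r+j+1<n)

  startsWithRun : ℕ → ℕ → ℕ → ℕ
  startsWithRun d s j = ⟦ s + j <? n ⟧ * (⟦ s + suc j ≤? d ⟧ * compositions (d ∸ (s + suc j)))

  traceSum : ℕ → ℕ
  traceSum d = ∑< n (λ s → ∑< n (startsWithRun d s))

  paths-closed : ∀ d′ s → s < n → paths s s (suc d′) ≡ ∑< n (startsWithRun (suc d′) s)
  paths-closed d′ s s<n = begin
    paths s s d                                                                ≡⟨ paths-by-first-false d s s s<n ⟩
    ∑< d (λ j → ⟦ s + j <? n ⟧ * paths 0 s (d ∸ suc j)) + ⟦ s + d ≟ s ⟧ * ⟦ s + d <? n ⟧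
      ≡⟨ cong₂ _+_ (∑<-cong d (λ j j<d → cong (⟦ s + j <? n ⟧ *_) (rest j j<d))) (cong (_* ⟦ s + d <? n ⟧) (⟦⟧-no (s + d ≟ s) (m+1+n≢m s))) ⟩
    ∑< d (startsWithRun d s) + 0                                               ≡⟨ +-identityʳ _ ⟩
    ∑< d (startsWithRun d s)                                                   ≡⟨ ∑<-extend d n (startsWithRun d s) beyond-d beyond-n ⟩
    ∑< n (startsWithRun d s)                                                   ∎
    where
    open ≡-Reasoning
    d = suc d′
    rest : ∀ j → j < d → paths 0 s (d ∸ suc j) ≡ ⟦ s + suc j ≤? d ⟧ * compositions (d ∸ (s + suc j))
    rest j j<d = trans (paths-from-0 s s<n (d ∸ suc j)) (cong₂ _*_
      (⟦⟧-cong (s ≤? d ∸ suc j) (s + suc j ≤? d) (m≤o∸n⇒m+n≤o s j<d) (m+n≤o⇒m≤o∸n s))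
      (cong compositions (trans (∸-+-assoc d (suc j) s) (cong (d ∸_) (+-comm (suc j) s)))))
    beyond-d : ∀ j → d ≤ j → startsWithRun d s j ≡ 0
    beyond-d j d≤j = trans (cong (λ z → ⟦ s + j <? n ⟧ * (z * compositions (d ∸ (s + suc j))))
        (⟦⟧-no (s + suc j ≤? d) (λ s+j+1≤d → <⇒≱ (s≤s (≤-trans d≤j (m≤n+m j s))) (subst (_≤ d) (+-suc s j) s+j+1≤d))))
      (*-zeroʳ ⟦ s + j <? n ⟧)
    beyond-n : ∀ j → n ≤ j → startsWithRun d s j ≡ 0
    beyond-n j n≤j = cong (_* (⟦ s + suc j ≤? d ⟧ * compositions (d ∸ (s + suc j))))
      (⟦⟧-no (s + j <? n) (λ s+j<n → <⇒≱ s+j<n (≤-trans n≤j (m≤n+m j s))))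

  startsWithRun-rec : ∀ d s j → n < d → startsWithRun d s j ≡ ∑< n (λ c → startsWithRun (d ∸ suc c) s j)
  startsWithRun-rec d s j n<d = by-run-length (s + j <? n)
    where
    t = s + suc j
    0<t : 0 < t
    0<t = subst (0 <_) (sym (+-suc s j)) (s≤s z≤n)
    t≤t+y∸c⇔c≤y : ∀ y c → (t ≤ t + y ∸ c → c ≤ y) × (c ≤ y → t ≤ t + y ∸ c)
    t≤t+y∸c⇔c≤y y c = to , λ c≤y → m+n≤o⇒m≤o∸n t (+-monoʳ-≤ t c≤y)
      where
      to : t ≤ t + y ∸ c → c ≤ y
      to t≤ with c ≤? t + y
      ... | yes c≤t+y = +-cancelˡ-≤ t c y (m≤o∸n⇒m+n≤o t c≤t+y t≤)
      ... | no c≰t+y = ⊥-elim (<⇒≱ 0<t (subst (t ≤_) (m≤n⇒m∸n≡0 (<⇒≤ (≰⇒> c≰t+y))) t≤))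
    after-run : ∀ d → suc t ≤ d → ⟦ t ≤? d ⟧ * compositions (d ∸ t) ≡ ∑< n (λ c → ⟦ t ≤? d ∸ suc c ⟧ * compositions (d ∸ suc c ∸ t))
    after-run d t<d with m≤n⇒∃[o]m+o≡n t<d
    ... | y , refl = begin
      ⟦ t ≤? suc t + y ⟧ * compositions (suc t + y ∸ t) ≡⟨ trans (cong (_* compositions (suc t + y ∸ t))
                                                             (⟦⟧-yes (t ≤? suc t + y) (≤-trans (n≤1+n t) (m≤m+n (suc t) y)))) (+-identityʳ _) ⟩
      compositions (suc t + y ∸ t)                       ≡⟨ cong compositions (trans (cong (_∸ t) (sym (+-suc t y))) (m+n∸m≡n t (suc y))) ⟩
      compositions (suc y)                               ≡⟨ compositions-suc y ⟩
      ∑< n (λ c → ⟦ c ≤? y ⟧ * compositions (y ∸ c))     ≡⟨ ∑<-cong n (λ c _ → sym (cong₂ _*_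
                                                             (⟦⟧-cong (t ≤? t + y ∸ c) (c ≤? y) (proj₁ (t≤t+y∸c⇔c≤y y c)) (proj₂ (t≤t+y∸c⇔c≤y y c)))
                                                             (cong compositions (trans (∸-+-assoc (t + y) c t)
                                                               (trans (cong (t + y ∸_) (+-comm c t)) ([m+n]∸[m+o]≡n∸o t y c)))))) ⟩
      ∑< n (λ c → ⟦ t ≤? t + y ∸ c ⟧ * compositions (t + y ∸ c ∸ t)) ∎
      where open ≡-Reasoning
    by-run-length : (s+j<n? : Dec (s + j < n)) → ⟦ s+j<n? ⟧ * (⟦ t ≤? d ⟧ * compositions (d ∸ t)) ≡
      ∑< n (λ c → ⟦ s+j<n? ⟧ * (⟦ t ≤? d ∸ suc c ⟧ * compositions (d ∸ suc c ∸ t)))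
    by-run-length (no _) = sym (∑<-zero n (λ _ _ → refl))
    by-run-length (yes s+j<n) = trans (*-identityˡ _) (trans (after-run d (≤-trans (s≤s (subst (_≤ n) (sym (+-suc s j)) s+j<n)) n<d))
      (∑<-cong n (λ c _ → sym (*-identityˡ _))))

  traceSum-rec : ∀ d → n < d → traceSum d ≡ ∑< n (λ c → traceSum (d ∸ suc c))
  traceSum-rec d n<d = begin
    ∑< n (λ s → ∑< n (λ j → startsWithRun d s j))                           ≡⟨ ∑<-cong n (λ s _ → ∑<-cong n (λ j _ → startsWithRun-rec d s j n<d)) ⟩
    ∑< n (λ s → ∑< n (λ j → ∑< n (λ c → startsWithRun (d ∸ suc c) s j)))   ≡⟨ ∑<-cong n (λ s _ → ∑-swap (upTo n) (upTo n) _) ⟩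
    ∑< n (λ s → ∑< n (λ c → ∑< n (λ j → startsWithRun (d ∸ suc c) s j)))   ≡⟨ ∑-swap (upTo n) (upTo n) _ ⟩
    ∑< n (λ c → traceSum (d ∸ suc c))                                        ∎
    where open ≡-Reasoning

  runFree≡traceSum : ∀ d′ → runFree n (suc d′) ≡ traceSum (suc d′)
  runFree≡traceSum d′ = begin
    runFree n (suc d′)                       ≡⟨ runFree≡trace d′ ⟩
    ∑< n (λ s → accepts s s (suc d′))        ≡⟨ ∑<-cong n (λ s s<n → trans (accepts≡paths (suc d′) s s) (paths-closed d′ s s<n)) ⟩
    traceSum (suc d′)                        ∎
    where open ≡-Reasoning

  runFree-rec : ∀ d → n < d → runFree n d ≡ ∑< n (λ c → runFree n (d ∸ suc c))
  runFree-rec (suc d′) n<d = begin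
    runFree n (suc d′)                        ≡⟨ runFree≡traceSum d′ ⟩
    traceSum (suc d′)                         ≡⟨ traceSum-rec (suc d′) n<d ⟩
    ∑< n (λ c → traceSum (suc d′ ∸ suc c))    ≡⟨ ∑<-cong n (λ c c<n → sym (positive (suc d′ ∸ suc c) (m+n≤o⇒m≤o∸n 1 (≤-trans (s≤s c<n) n<d)))) ⟩
    ∑< n (λ c → runFree n (suc d′ ∸ suc c))   ∎
    where
    open ≡-Reasoning
    positive : ∀ x → 0 < x → runFree n x ≡ traceSum x
    positive (suc x) _ = runFree≡traceSum x

-- Words without cyclic runs and the n-step Lucas numbers

runFree-0 : ∀ d → runFree 0 d ≡ 0
runFree-0 zero = refl
runFree-0 (suc d′) = ∑-zero (words (suc d′)) (λ v _ → ⟦⟧-no (¬? (hasCyclicRun? 0 v)) (λ ¬run → ¬run (0 , s≤s z≤n , λ ())))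

-- A window of n ≥ d letters covers every residue mod d, so only the all-true word has a cyclic run.
module ShortWords (n d′ : ℕ) (d≤n : suc d′ ≤ n) where

  private
    d = suc d′

  allTrue : Vec Bool d
  allTrue = tabulateℕ d (λ _ → true)

  hasCyclicRun⇒allTrue : ∀ v → HasCyclicRun n v → v ≡ allTrue
  hasCyclicRun⇒allTrue v (j , _ , window) = cyclic-ext v allTrue (λ i _ → begin
    cyclic v i                ≡⟨ cyclic-periodic v j i ⟨
    cyclic v (i + j * d)      ≡⟨ cong (cyclic v) (trans (reorder i j d′) (cong (j +_) (m≡m%n+[m/n]*n (i + d′ * j) d))) ⟩
    cyclic v (j + ((i + d′ * j) % d + (i + d′ * j) / d * d)) ≡⟨ cong (cyclic v) (+-assoc j _ _) ⟨
    cyclic v (j + (i + d′ * j) % d + (i + d′ * j) / d * d) ≡⟨ cyclic-periodic v ((i + d′ * j) / d) (j + (i + d′ * j) % d) ⟩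
    cyclic v (j + (i + d′ * j) % d) ≡⟨ window (≤-trans (m%n<n (i + d′ * j) d) d≤n) ⟩
    true                      ≡⟨ cyclic-tabulateℕ d′ (λ _ → true) i ⟨
    cyclic allTrue i          ∎)
    where
    open ≡-Reasoning
    reorder : ∀ i j d′ → i + j * suc d′ ≡ j + (i + d′ * j)
    reorder = solve-∀

  allTrue-hasCyclicRun : HasCyclicRun n allTrue
  allTrue-hasCyclicRun = 0 , s≤s z≤n , λ {k} _ → cyclic-tabulateℕ d′ (λ _ → true) k

  runFree-short : runFree n d ≡ 2 ^ d ∸ 1
  runFree-short = begin
    ∑ (words d) (λ v → ⟦ ¬? (hasCyclicRun? n v) ⟧)   ≡⟨ ∑-cong (words d) (λ v → ⟦⟧-cong (¬? (hasCyclicRun? n v)) (¬? (v ≟ᵛ allTrue))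
                                                          (λ ¬run v≡ → ¬run (subst (HasCyclicRun n) (sym v≡) allTrue-hasCyclicRun))
                                                          (λ v≢ run → v≢ (hasCyclicRun⇒allTrue v run))) ⟩
    ∑ (words d) (λ v → ⟦ ¬? (v ≟ᵛ allTrue) ⟧)        ≡⟨ m+n∸m≡n 1 _ ⟨
    1 + ∑ (words d) (λ v → ⟦ ¬? (v ≟ᵛ allTrue) ⟧) ∸ 1
      ≡⟨ cong (λ z → z + ∑ (words d) (λ v → ⟦ ¬? (v ≟ᵛ allTrue) ⟧) ∸ 1) (words-enumerates d allTrue) ⟨
    ∑ (words d) (λ v → ⟦ v ≟ᵛ allTrue ⟧) + ∑ (words d) (λ v → ⟦ ¬? (v ≟ᵛ allTrue) ⟧) ∸ 1
      ≡⟨ cong (_∸ 1) (trans (∑-⟦⟧+∑-⟦¬⟧ (_≟ᵛ allTrue) (words d)) (length-words d)) ⟩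
    2 ^ d ∸ 1                                        ∎
    where open ≡-Reasoning

module LucasCount (n′ : ℕ) where

  private
    n = suc n′

  runFrees : ℕ → List ℕ
  runFrees zero = []
  runFrees (suc m) = runFree n (suc m) ∷ runFrees m

  sum-take-runFrees : ∀ k m → k ≤ m → sum (take k (runFrees m)) ≡ ∑< k (λ c → runFree n (m ∸ c))
  sum-take-runFrees zero m _ = refl
  sum-take-runFrees (suc k) (suc m) (s≤s k≤m) =
    trans (cong (runFree n (suc m) +_) (sum-take-runFrees k m k≤m)) (sym (∑<-suc k (λ c → runFree n (suc m ∸ c))))

  lucasList≡runFrees : ∀ m → lucasList n m ≡ runFrees m
  lucasList≡runFrees zero = refl
  lucasList≡runFrees (suc m) with m <ᵇ n in m<ᵇn
  ... | true = cong₂ _∷_ (sym (ShortWords.runFree-short n m (<ᵇ⇒< m n (subst T (sym m<ᵇn) _)))) (lucasList≡runFrees m)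
  ... | false = cong₂ _∷_ (begin
    sum (take n (lucasList n m))           ≡⟨ cong (sum ∘ take n) (lucasList≡runFrees m) ⟩
    sum (take n (runFrees m))              ≡⟨ sum-take-runFrees n m (≤-pred (≰⇒> m≮n)) ⟩
    ∑< n (λ c → runFree n (m ∸ c))         ≡⟨ PathCounts.runFree-rec n′ (suc m) (≰⇒> m≮n) ⟨
    runFree n (suc m)                      ∎) (lucasList≡runFrees m)
    where
    open ≡-Reasoning
    m≮n : ¬ (m < n)
    m≮n m<n = subst T m<ᵇn (<⇒<ᵇ m<n)

L≡runFree : ∀ n m → L n (suc m) ≡ runFree n (suc m)
L≡runFree zero m = sym (runFree-0 (suc m))
L≡runFree (suc n′) m rewrite LucasCount.lucasList≡runFrees n′ (suc m) = refl

-- The orbit count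

open import Data.Integer using (+_)

module OrbitCount (k n : ℕ) (n≤l : n ≤ suc k) where

  private
    l = suc k

  weighted : (ℕ → ℕ) → ℕ → ℕ
  weighted F m = φ (l / suc (m ∸ 1)) * F m

  fold-characterisation : (g : List ℕ → ℤ) → g [] ≡ + 0 →
    (∀ m ms → g (m ∷ ms) ≡ + φ (l / suc (m ∸ 1)) ℤ.* (+ (2 ^ m) ℤ.- + L n m) ℤ.+ g ms) →
    ∀ ds → g ds ≡ + ∑ ds (weighted (2 ^_)) ℤ.- + ∑ ds (weighted (L n))
  fold-characterisation g g[] g∷ [] = g[]
  fold-characterisation g g[] g∷ (m ∷ ms) = begin
    g (m ∷ ms)
      ≡⟨ g∷ m ms ⟩
    + φ′ ℤ.* (+ (2 ^ m) ℤ.- + L n m) ℤ.+ g ms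
      ≡⟨ cong (λ z → + φ′ ℤ.* (+ (2 ^ m) ℤ.- + L n m) ℤ.+ z) (fold-characterisation g g[] g∷ ms) ⟩
    + φ′ ℤ.* (+ (2 ^ m) ℤ.- + L n m) ℤ.+ (+ ∑ ms (weighted (2 ^_)) ℤ.- + ∑ ms (weighted (L n)))
      ≡⟨ distribute (+ φ′) (+ (2 ^ m)) (+ L n m) _ _ ⟩
    (+ φ′ ℤ.* + (2 ^ m) ℤ.+ + ∑ ms (weighted (2 ^_))) ℤ.- (+ φ′ ℤ.* + L n m ℤ.+ + ∑ ms (weighted (L n)))
      ≡⟨ cong₂ ℤ._-_ (pos-weighted (2 ^_)) (pos-weighted (L n)) ⟨
    + ∑ (m ∷ ms) (weighted (2 ^_)) ℤ.- + ∑ (m ∷ ms) (weighted (L n)) ∎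
    where
    open ≡-Reasoning
    φ′ = φ (l / suc (m ∸ 1))
    distribute : ∀ a b c x y → a ℤ.* (b ℤ.- c) ℤ.+ (x ℤ.- y) ≡ (a ℤ.* b ℤ.+ x) ℤ.- (a ℤ.* c ℤ.+ y)
    distribute = ℤ-Solver.solve-∀
    pos-weighted : ∀ F → + ∑ (m ∷ ms) (weighted F) ≡ + φ′ ℤ.* + F m ℤ.+ + ∑ ms (weighted F)
    pos-weighted F = trans (pos-+ (weighted F m) _) (cong (ℤ._+ + ∑ ms (weighted F)) (pos-* φ′ (F m)))

  -- orbitSum folds with a function local to its definition, which cannot be named here: after
  -- abstracting over divisors l, unification solves fold = _ as that function.
  orbitSum≡ : orbitSum l n ≡ + ∑ (divisors l) (weighted (2 ^_)) ℤ.- + ∑ (divisors l) (weighted (L n))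
  orbitSum≡ = by-fold
    where
    fold : List ℕ → ℤ
    fold = _
    by-fold : orbitSum l n ≡ + ∑ (divisors l) (weighted (2 ^_)) ℤ.- + ∑ (divisors l) (weighted (L n))
    by-fold with divisors l
    ... | ds = fold-characterisation fold refl (λ _ _ → refl) ds

  ∑-divisors : ∀ F → ∑ (divisors l) F ≡ ∑< l (λ j → ⟦ suc j ∣? l ⟧ * F (suc j))
  ∑-divisors F = trans (∑-filter (_∣? l) (map suc (upTo l)) F) (∑-map suc (upTo l) _)

  module _ (R : List (Word l)) (tr : IsOrbitTransversal l n R) where

    sum-identity : l * length R + ∑ (divisors l) (weighted (L n)) ≡ ∑ (divisors l) (weighted (2 ^_))
    sum-identity = begin
      l * length R + ∑ (divisors l) (weighted (L n))
        ≡⟨ cong₂ _+_ (Burnside.burnside n≤l R tr) (∑-divisors (weighted (L n))) ⟩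
      ∑< l (fixedWithRun n≤l) + ∑< l (λ j → ⟦ suc j ∣? l ⟧ * weighted (L n) (suc j))
        ≡⟨ cong (λ z → ∑< l (fixedWithRun n≤l) + z) (∑<-cong l (λ j _ → cong (λ z → ⟦ suc j ∣? l ⟧ * (φ (l / suc j) * z)) (L≡runFree n j))) ⟩
      ∑< l (fixedWithRun n≤l) + ∑< l (λ j → ⟦ suc j ∣? l ⟧ * (φ (l / suc j) * runFree n (suc j)))
        ≡⟨ cong (λ z → ∑< l (fixedWithRun n≤l) + z) (∑<-by-gcd k (runFree n)) ⟨
      ∑< l (fixedWithRun n≤l) + ∑< l (λ i → runFree n (gcd i l))
        ≡⟨ ∑-+ (upTo l) (fixedWithRun n≤l) (λ i → runFree n (gcd i l)) ⟨
      ∑< l (λ i → fixedWithRun n≤l i + runFree n (gcd i l))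
        ≡⟨ ∑<-cong l (λ i _ → fixedWithRun+runFree n≤l i) ⟩
      ∑< l (λ i → 2 ^ gcd i l)
        ≡⟨ ∑<-by-gcd k (2 ^_) ⟩
      ∑< l (λ j → ⟦ suc j ∣? l ⟧ * weighted (2 ^_) (suc j))
        ≡⟨ ∑-divisors (weighted (2 ^_)) ⟨
      ∑ (divisors l) (weighted (2 ^_)) ∎
      where open ≡-Reasoning

    orbit-count : + (l * length R) ≡ orbitSum l n
    orbit-count = sym (begin
      orbitSum l n                                     ≡⟨ orbitSum≡ ⟩
      + ∑ (divisors l) (weighted (2 ^_)) ℤ.- + lucas   ≡⟨ cong (λ z → + z ℤ.- + lucas) sum-identity ⟨
      + (l * length R + lucas) ℤ.- + lucas             ≡⟨ cong (ℤ._- + lucas) (pos-+ (l * length R) lucas) ⟩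
      + (l * length R) ℤ.+ + lucas ℤ.- + lucas         ≡⟨ cancel (+ (l * length R)) (+ lucas) ⟩
      + (l * length R)                                 ∎)
      where
      open ≡-Reasoning
      lucas = ∑ (divisors l) (weighted (L n))
      cancel : ∀ x y → x ℤ.+ y ℤ.- y ≡ x
      cancel = ℤ-Solver.solve-∀

proposition5p10 : (k n : ℕ) → n ≤ suc k →
    (∃[ R ] IsOrbitTransversal (suc k) n R) ×
    (∀ (R : List (Word (suc k))) → IsOrbitTransversal (suc k) n R →
      + (suc k * length R) ≡ orbitSum (suc k) n)
proposition5p10 k n n≤l = Transversal.transversal n≤l , OrbitCount.orbit-count k n n≤l
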